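{- Let $n\geq 5$ and $m\in\{0,1,2,3,\binom n2,\binom n2-1,\binom n2-2,\binom n2-3\}$. Then $S^1_{n,m}$ is the only $H$-optimal graph in $\mathcal{G}_{n,m}$.
   Context: $\mathcal{G}_{n,m}$ is the set of simple graphs on $n$ vertices with $m$ edges. $M_1(G)=\sum_v d_G(v)^2$, $M_2(G)=\sum_{uv\in E(G)}d_G(u)d_G(v)$, $k_3(G)$ = number of triangles, $H(G)=M_2(G)-6k_3(G)$. A graph in $\mathcal{G}_{n,m}$ is $M$-optimal if it maximizes $M_1$ over $\mathcal{G}_{n,m}$, and $H$-optimal if it is $M$-optimal and maximizes $H$ among the $M$-optimal graphs of $\mathcal{G}_{n,m}$. Let $j',k'$ be the unique integers with $1\leq j'\leq k'$ and $m=\binom n2-\binom{k'+1}{2}+j'$; then $S^1_{n,m}=K_{n-k'-1}\vee((K_1\vee j'K_1)\cup(k'-j')K_1)$ (the quasi-star), where $\vee$ is join, $\cup$ disjoint union, $sK_1$ is $s$ isolated vertices. -}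

module Defs where

open import Data.Bool using (Bool; true; false; if_then_else_; _∧_; _∨_)
open import Data.Nat using (ℕ; zero; suc; _+_; _*_; _≤_; _<ᵇ_; _≡ᵇ_; _≤ᵇ_)
open import Data.Nat.Combinatorics using (_C_)
open import Data.Fin using (Fin; toℕ)
open import Data.Fin.Permutation using (Permutation′; _⟨$⟩ʳ_)
open import Data.Integer as ℤ using (ℤ; +_)
open import Data.Product using (_×_; Σ)
open import Data.Bool.Properties using (∨-comm)
open import Data.Empty using (⊥-elim)
open import Relation.Nullary using (does; yes; no)
import Data.Fin as F
import Relation.Binary.PropositionalEquality as P
open import Relation.Binary.PropositionalEquality using (_≡_; refl)

∑ : (n : ℕ) → (Fin n → ℕ) → ℕ
∑ zero    f = 0
∑ (suc n) f = f F.zero + ∑ n (λ i → f (F.suc i))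

ind : Bool → ℕ
ind true  = 1
ind false = 0

record Graph (n : ℕ) : Set where
  field
    adj    : Fin n → Fin n → Bool
    sym    : ∀ i j → adj i j ≡ adj j i
    irrefl : ∀ i → adj i i ≡ false
open Graph public

module _ {n : ℕ} (G : Graph n) where
  deg : Fin n → ℕ
  deg i = ∑ n (λ j → ind (adj G i j))

  edges : ℕ
  edges = ∑ n (λ i → ∑ n (λ j → ind ((toℕ i <ᵇ toℕ j) ∧ adj G i j)))

  M₁ : ℕ
  M₁ = ∑ n (λ i → deg i * deg i)

  M₂ : ℕ
  M₂ = ∑ n (λ i → ∑ n (λ j →
         if (toℕ i <ᵇ toℕ j) ∧ adj G i j then deg i * deg j else 0))

  k₃ : ℕ
  k₃ = ∑ n (λ i → ∑ n (λ j → ∑ n (λ k →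
         ind ((toℕ i <ᵇ toℕ j) ∧ (toℕ j <ᵇ toℕ k)
              ∧ adj G i j ∧ adj G j k ∧ adj G i k))))

  H : ℤ
  H = + M₂ ℤ.- + (6 * k₃)

InG : (n m : ℕ) → Graph n → Set
InG n m G = edges G ≡ m

MOptimal : (n m : ℕ) → Graph n → Set
MOptimal n m G = InG n m G × (∀ (G' : Graph n) → InG n m G' → M₁ G' ≤ M₁ G)

HOptimal : (n m : ℕ) → Graph n → Set
HOptimal n m G = MOptimal n m G × (∀ (G' : Graph n) → MOptimal n m G' → H G' ℤ.≤ H G)

_≅_ : {n : ℕ} → Graph n → Graph n → Set
_≅_ {n} G G' = Σ (Permutation′ n) λ σ →
  ∀ i j → adj G i j ≡ adj G' (σ ⟨$⟩ʳ i) (σ ⟨$⟩ʳ j)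

-- The quasi-star S¹ = K_{n-k-1} ∨ ((K₁ ∨ jK₁) ∪ (k-j)K₁) on vertex set Fin n.
-- Vertex v has position p = toℕ v + 1 ∈ {1..n}:
--   core  (the K_{n-k-1}):  p ≤ n - k - 1
--   centre (the K₁):        p = n - k
--   leaves (the jK₁):       n - k < p ≤ n - k + j
--   isolated ((k-j)K₁):     otherwise
-- (written without truncated subtraction; when k = n, i.e. m = 0, the "K_{-1}"
--  is read as removing the centre, giving the empty graph).
module QuasiStar (n k j : ℕ) where
  pos+k : ∀ {n'} → Fin n' → ℕ
  pos+k v = suc (toℕ v) + k

  core centre leaf : ∀ {n'} → Fin n' → Bool
  core v   = suc (pos+k v) ≤ᵇ n
  centre v = pos+k v ≡ᵇ n
  leaf v   = (n <ᵇ pos+k v) ∧ (pos+k v ≤ᵇ n + j)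

  rel : ∀ {n'} → Fin n' → Fin n' → Bool
  rel u v = core u ∨ (centre u ∧ leaf v)

  qadj : Fin n → Fin n → Bool
  qadj u v = if does (u F.≟ v) then false else (rel u v ∨ rel v u)

  qsym : ∀ u v → qadj u v ≡ qadj v u
  qsym u v with u F.≟ v | v F.≟ u
  ... | yes _ | yes _ = refl
  ... | yes p | no ¬q = ⊥-elim (¬q (P.sym p))
  ... | no ¬p | yes q = ⊥-elim (¬p (P.sym q))
  ... | no _  | no _  = ∨-comm (rel u v) (rel v u)

  qirrefl : ∀ u → qadj u u ≡ false
  qirrefl u with u F.≟ u
  ... | yes _ = refl
  ... | no ¬p = ⊥-elim (¬p refl)

quasiStar : (n k j : ℕ) → Graph n
quasiStar n k j = record { adj = qadj ; sym = qsym ; irrefl = qirrefl }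
  where open QuasiStar n k j

{-# OPTIONS --safe #-}
-- For m ≤ 3 every graph with m edges that maximises M₁ is the star K_{1,m}, except that for m = 3
-- the triangle is a second maximiser, with smaller H (6 < 9); the quasi-star is K_{1,m} plus isolated
-- vertices. For m = C(n,2) − t with t ≤ 3 pass to complements: for fixed n and m, M₁(G) increases
-- with M₁(Ḡ), and both M₂(G) + M₂(Ḡ) and k₃(G) + k₃(Ḡ) depend only on n, m and M₁(G) (for k₃ this is
-- Goodman's count of two-coloured triangles), so H(G) − H(S) = H(S̄) − H(Ḡ) between M-optimal graphs.
-- Hence the H-optimal graphs are the complements of the M-optimal graphs with t edges of least H:
-- the empty graph, K₂, P₃ and K₃, which are exactly the complements of the quasi-stars.

module Submission where

open import Defs renaming (sym to adj-sym)
import Algebra.Properties.CommutativeMonoid.Sum as MonoidSum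
open import Data.Bool using (Bool; true; false; not; _∧_; _∨_; if_then_else_; T)
open import Data.Bool.Properties using (∧-comm; ∨-comm; ∧-zeroʳ; ∧-identityʳ; ∨-identityʳ; ∨-zeroʳ; not-involutive)
  renaming (_≟_ to _≟ᵇ_)
open import Data.Empty using (⊥; ⊥-elim)
open import Data.Fin as F using (Fin; toℕ; _↑ˡ_; _↑ʳ_)
import Data.Fin.Properties as FP
open import Data.Fin.Permutation as Perm using (Permutation′; _⟨$⟩ʳ_; _⟨$⟩ˡ_; _∘ₚ_)
open import Data.Integer as ℤ using (ℤ; _⊖_)
import Data.Integer.Properties as ℤP
open import Data.List using (List; []; _∷_)
open import Data.List.Relation.Unary.All using (All; []; _∷_)
open import Data.Nat using (ℕ; zero; suc; _+_; _*_; _∸_; _≤_; _<_; s≤s; z≤n; _<ᵇ_; _≤ᵇ_; _≡ᵇ_)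
import Data.Nat.Properties as NP
open import Data.Nat.Combinatorics using (_C_; nCk+nC[k+1]≡[n+1]C[k+1]; nC1≡n)
open import Data.Nat.Tactic.RingSolver using (solve-∀)
open import Data.Product using (_×_; _,_; proj₁; proj₂; Σ; ∃-syntax)
open import Data.Sum using (_⊎_; inj₁; inj₂; [_,_]′)
open import Data.Unit using (⊤; tt)
open import Relation.Binary.Definitions using (tri<; tri≈; tri>)
open import Relation.Binary.PropositionalEquality
  using (_≡_; _≢_; refl; sym; trans; cong; cong₂; subst; subst₂; ≢-sym; module ≡-Reasoning)
open import Relation.Nullary using (¬_; yes; no; does)
open import Relation.Nullary.Decidable using (dec-true; dec-false; True; toWitness)
open MonoidSum NP.+-0-commutativeMonoid using (sum; sum-permute)
open ≡-Reasoning

_==_ : ∀ {n} → Fin n → Fin n → Bool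
x == y = does (x F.≟ y)

==-refl : ∀ {n} (x : Fin n) → (x == x) ≡ true
==-refl x = dec-true (x F.≟ x) refl

==-≢ : ∀ {n} {x y : Fin n} → x ≢ y → (x == y) ≡ false
==-≢ {x = x} {y} = dec-false (x F.≟ y)

==⇒≡ : ∀ {n} {x y : Fin n} → (x == y) ≡ true → x ≡ y
==⇒≡ {x = x} {y} e with x F.≟ y
... | yes p = p

==-sym : ∀ {n} (x y : Fin n) → (x == y) ≡ (y == x)
==-sym x y with x F.≟ y | y F.≟ x
... | yes _ | yes _ = refl
... | no _  | no _  = refl
... | yes p | no q  = ⊥-elim (q (sym p))
... | no p  | yes q = ⊥-elim (p (sym q))

≡-or-≢ : ∀ {n} (x y : Fin n) → x ≡ y ⊎ x ≢ y
≡-or-≢ x y with x F.≟ y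
... | yes e = inj₁ e
... | no ne = inj₂ ne

true≢false : true ≢ false
true≢false ()

Bool-ext : ∀ {a b : Bool} → (T a → T b) → (T b → T a) → a ≡ b
Bool-ext {true}  {true}  _ _ = refl
Bool-ext {true}  {false} f _ = ⊥-elim (f tt)
Bool-ext {false} {true}  _ g = ⊥-elim (g tt)
Bool-ext {false} {false} _ _ = refl

ind-true : ∀ {b} → 0 < ind b → b ≡ true
ind-true {true} _ = refl

ind-false : ∀ {b} → ind b ≡ 0 → b ≡ false
ind-false {false} _ = refl

ind-∧ : ∀ a b → ind (a ∧ b) ≡ ind a * ind b
ind-∧ true  b = sym (NP.+-identityʳ (ind b))
ind-∧ false b = refl

δ : ∀ {n} → Fin n → Fin n → ℕ
δ x i = ind (i == x)

δ-self : ∀ {n} (x : Fin n) → δ x x ≡ 1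
δ-self x = cong ind (==-refl x)

δ-≢ : ∀ {n} {x u : Fin n} → u ≢ x → δ x u ≡ 0
δ-≢ ne = cong ind (==-≢ ne)

∑-cong : ∀ n {f g : Fin n → ℕ} → (∀ i → f i ≡ g i) → ∑ n f ≡ ∑ n g
∑-cong zero    h = refl
∑-cong (suc n) h = cong₂ _+_ (h F.zero) (∑-cong n (λ i → h (F.suc i)))

∑-zero : ∀ n {f : Fin n → ℕ} → (∀ i → f i ≡ 0) → ∑ n f ≡ 0
∑-zero zero    h = refl
∑-zero (suc n) h = cong₂ _+_ (h F.zero) (∑-zero n (λ i → h (F.suc i)))

∑-distrib-+ : ∀ n (f g : Fin n → ℕ) → ∑ n (λ i → f i + g i) ≡ ∑ n f + ∑ n g
∑-distrib-+ zero    f g = refl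
∑-distrib-+ (suc n) f g =
  trans (cong (f F.zero + g F.zero +_) (∑-distrib-+ n (λ i → f (F.suc i)) (λ i → g (F.suc i))))
        (interchange (f F.zero) (g F.zero) _ _)
  where
  interchange : ∀ a b c d → a + b + (c + d) ≡ a + c + (b + d)
  interchange = solve-∀

∑-*ˡ : ∀ n c (f : Fin n → ℕ) → ∑ n (λ i → c * f i) ≡ c * ∑ n f
∑-*ˡ zero    c f = sym (NP.*-zeroʳ c)
∑-*ˡ (suc n) c f =
  trans (cong (c * f F.zero +_) (∑-*ˡ n c (λ i → f (F.suc i)))) (sym (NP.*-distribˡ-+ c (f F.zero) _))

∑-*ʳ : ∀ n c (f : Fin n → ℕ) → ∑ n (λ i → f i * c) ≡ ∑ n f * c
∑-*ʳ n c f = trans (∑-cong n (λ i → NP.*-comm (f i) c)) (trans (∑-*ˡ n c f) (NP.*-comm c _))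

∑-const : ∀ n c → ∑ n (λ _ → c) ≡ n * c
∑-const zero    c = refl
∑-const (suc n) c = cong (c +_) (∑-const n c)

∑-swap : ∀ n m (f : Fin n → Fin m → ℕ) →
  ∑ n (λ i → ∑ m (λ j → f i j)) ≡ ∑ m (λ j → ∑ n (λ i → f i j))
∑-swap zero    m f = sym (∑-zero m (λ _ → refl))
∑-swap (suc n) m f =
  trans (cong (∑ m (f F.zero) +_) (∑-swap n m (λ i → f (F.suc i))))
        (sym (∑-distrib-+ m (f F.zero) _))

∑∑-product : ∀ n (f g : Fin n → ℕ) → ∑ n (λ i → ∑ n (λ j → f i * g j)) ≡ ∑ n f * ∑ n g
∑∑-product n f g = trans (∑-cong n (λ i → ∑-*ˡ n (f i) g)) (∑-*ʳ n (∑ n g) f)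

∑≡0⇒ : ∀ n (f : Fin n → ℕ) → ∑ n f ≡ 0 → ∀ i → f i ≡ 0
∑≡0⇒ (suc n) f e F.zero    = NP.m+n≡0⇒m≡0 (f F.zero) e
∑≡0⇒ (suc n) f e (F.suc i) = ∑≡0⇒ n (λ i → f (F.suc i)) (NP.m+n≡0⇒n≡0 (f F.zero) e) i

∑-pos : ∀ n (f : Fin n → ℕ) → 0 < ∑ n f → ∃[ i ] 0 < f i
∑-pos (suc n) f p with f F.zero in eq
... | suc _ = F.zero , subst (0 <_) (sym eq) (s≤s z≤n)
... | zero with ∑-pos n (λ i → f (F.suc i)) p
...   | i , q = F.suc i , q

∑-δ : ∀ n (x : Fin n) (f : Fin n → ℕ) → ∑ n (λ i → δ x i * f i) ≡ f x
∑-δ (suc n) F.zero f =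
  trans (cong (f F.zero + 0 +_) (∑-zero n (λ _ → refl))) (trans (NP.+-identityʳ _) (NP.+-identityʳ _))
∑-δ (suc n) (F.suc x) f = ∑-δ n x (λ i → f (F.suc i))

∑-δ-one : ∀ n (x : Fin n) → ∑ n (δ x) ≡ 1
∑-δ-one n x = trans (∑-cong n (λ i → sym (NP.*-identityʳ (δ x i)))) (∑-δ n x (λ _ → 1))

∑-δʳ : ∀ n (x : Fin n) (f : Fin n → ℕ) → ∑ n (λ i → f i * δ x i) ≡ f x
∑-δʳ n x f = trans (∑-cong n (λ i → NP.*-comm (f i) (δ x i))) (∑-δ n x f)

∑-++ : ∀ s R (f : Fin (s + R) → ℕ) → ∑ (s + R) f ≡ ∑ s (λ p → f (p ↑ˡ R)) + ∑ R (λ i → f (s ↑ʳ i))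
∑-++ zero    R f = refl
∑-++ (suc s) R f = trans (cong (f F.zero +_) (∑-++ s R (λ i → f (F.suc i)))) (sym (NP.+-assoc (f F.zero) _ _))

∑-restrict : ∀ s R (f : Fin (s + R) → ℕ) → (∀ i → f (s ↑ʳ i) ≡ 0) → ∑ (s + R) f ≡ ∑ s (λ p → f (p ↑ˡ R))
∑-restrict s R f h =
  trans (∑-++ s R f) (trans (cong (∑ s (λ p → f (p ↑ˡ R)) +_) (∑-zero R h)) (NP.+-identityʳ _))

∑-permute : ∀ n (σ : Permutation′ n) (f : Fin n → ℕ) → ∑ n (λ i → f (σ ⟨$⟩ʳ i)) ≡ ∑ n f
∑-permute n σ f = trans (∑≡sum n _) (trans (sym (sum-permute f σ)) (sym (∑≡sum n f)))
  where
  ∑≡sum : ∀ n (f : Fin n → ℕ) → ∑ n f ≡ sum f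
  ∑≡sum zero    f = refl
  ∑≡sum (suc n) f = cong (f F.zero +_) (∑≡sum n _)

_<ᶠ_ : ∀ {n} → Fin n → Fin n → Bool
i <ᶠ j = toℕ i <ᵇ toℕ j

<ᶠ-true : ∀ {n} (i j : Fin n) → toℕ i < toℕ j → (i <ᶠ j) ≡ true
<ᶠ-true i j lt = T→true (NP.<⇒<ᵇ lt)
  where
  T→true : ∀ {b} → T b → b ≡ true
  T→true {true} _ = refl

<ᶠ-false : ∀ {n} (i j : Fin n) → ¬ toℕ i < toℕ j → (i <ᶠ j) ≡ false
<ᶠ-false i j ¬lt = ¬T→false (λ t → ¬lt (NP.<ᵇ⇒< (toℕ i) (toℕ j) t))
  where
  ¬T→false : ∀ {b} → ¬ T b → b ≡ false
  ¬T→false {false} _ = refl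
  ¬T→false {true}  f = ⊥-elim (f tt)

<ᶠ-trichotomy : ∀ {n} (i j : Fin n) → i ≢ j →
  ((i <ᶠ j) ≡ true × (j <ᶠ i) ≡ false) ⊎ ((i <ᶠ j) ≡ false × (j <ᶠ i) ≡ true)
<ᶠ-trichotomy i j ne with NP.<-cmp (toℕ i) (toℕ j)
... | tri< a _ ¬c = inj₁ (<ᶠ-true i j a , <ᶠ-false j i ¬c)
... | tri≈ _ b _  = ⊥-elim (ne (FP.toℕ-injective b))
... | tri> ¬a _ c = inj₂ (<ᶠ-false i j ¬a , <ᶠ-true j i c)

<ᶠ-trans : ∀ {n} (i j k : Fin n) → (i <ᶠ j) ≡ true → (j <ᶠ k) ≡ true → (i <ᶠ k) ≡ true
<ᶠ-trans i j k p q =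
  <ᶠ-true i k (NP.<-trans (<ᵇ⇒<′ i j p) (<ᵇ⇒<′ j k q))
  where
  <ᵇ⇒<′ : ∀ (a b : Fin _) → (a <ᶠ b) ≡ true → toℕ a < toℕ b
  <ᵇ⇒<′ a b e = NP.<ᵇ⇒< (toℕ a) (toℕ b) (subst T (sym e) tt)

<ᶠ-flip : ∀ {n} (i j : Fin n) → i ≢ j → (j <ᶠ i) ≡ not (i <ᶠ j)
<ᶠ-flip i j ne with <ᶠ-trichotomy i j ne
... | inj₁ (p , q) rewrite p | q = refl
... | inj₂ (p , q) rewrite p | q = refl

ind-split : ∀ a x → ind a * x + ind (not a) * x ≡ x
ind-split true  x = trans (NP.+-identityʳ _) (NP.+-identityʳ x)
ind-split false x = NP.+-identityʳ x

upper : ∀ {n} → (Fin n → Fin n → ℕ) → Fin n → Fin n → ℕ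
upper g i j = ind (i <ᶠ j) * g i j

∑∑-symmetric : ∀ n (g : Fin n → Fin n → ℕ) → (∀ i j → g i j ≡ g j i) → (∀ i → g i i ≡ 0) →
  ∑ n (λ i → ∑ n (λ j → g i j)) ≡ 2 * ∑ n (λ i → ∑ n (λ j → upper g i j))
∑∑-symmetric n g g-sym g-diag = begin
  ∑ n (λ i → ∑ n (λ j → g i j))
    ≡⟨ ∑-cong n (λ i → ∑-cong n (λ j → split i j)) ⟩
  ∑ n (λ i → ∑ n (λ j → upper g i j + upper g j i))
    ≡⟨ ∑-cong n (λ i → ∑-distrib-+ n (upper g i) (λ j → upper g j i)) ⟩
  ∑ n (λ i → ∑ n (upper g i) + ∑ n (λ j → upper g j i))
    ≡⟨ ∑-distrib-+ n _ _ ⟩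
  S + ∑ n (λ i → ∑ n (λ j → upper g j i))
    ≡⟨ cong (S +_) (trans (∑-swap n n (λ i j → upper g j i)) (sym (NP.+-identityʳ S))) ⟩
  2 * S ∎
  where
  S = ∑ n (λ i → ∑ n (λ j → upper g i j))
  split : ∀ i j → g i j ≡ upper g i j + upper g j i
  split i j with i F.≟ j
  ... | yes refl = trans (g-diag i) (sym (cong₂ _+_ z z))
    where z = trans (cong (ind (i <ᶠ i) *_) (g-diag i)) (NP.*-zeroʳ (ind (i <ᶠ i)))
  ... | no ne rewrite <ᶠ-flip i j ne | sym (g-sym i j) = sym (ind-split (i <ᶠ j) (g i j))

∑∑∑ : ∀ n → (Fin n → Fin n → Fin n → ℕ) → ℕ
∑∑∑ n t = ∑ n (λ i → ∑ n (λ j → ∑ n (λ k → t i j k)))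

∑∑∑-cong : ∀ n {s t : Fin n → Fin n → Fin n → ℕ} → (∀ i j k → s i j k ≡ t i j k) → ∑∑∑ n s ≡ ∑∑∑ n t
∑∑∑-cong n h = ∑-cong n (λ i → ∑-cong n (λ j → ∑-cong n (λ k → h i j k)))

∑∑∑-distrib-+ : ∀ n s t → ∑∑∑ n (λ i j k → s i j k + t i j k) ≡ ∑∑∑ n s + ∑∑∑ n t
∑∑∑-distrib-+ n s t =
  trans (∑-cong n (λ i → trans (∑-cong n (λ j → ∑-distrib-+ n (s i j) (t i j))) (∑-distrib-+ n _ _)))
        (∑-distrib-+ n _ _)

∑∑∑-*ˡ : ∀ n c t → ∑∑∑ n (λ i j k → c * t i j k) ≡ c * ∑∑∑ n t
∑∑∑-*ˡ n c t =
  trans (∑-cong n (λ i → trans (∑-cong n (λ j → ∑-*ˡ n c (t i j))) (∑-*ˡ n c _))) (∑-*ˡ n c _)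

∑∑∑-swap₂₃ : ∀ n t → ∑∑∑ n (λ i j k → t i k j) ≡ ∑∑∑ n t
∑∑∑-swap₂₃ n t = ∑-cong n (λ i → ∑-swap n n (λ j k → t i k j))

∑∑∑-swap₁₂ : ∀ n t → ∑∑∑ n (λ i j k → t j i k) ≡ ∑∑∑ n t
∑∑∑-swap₁₂ n t = ∑-swap n n (λ i j → ∑ n (λ k → t j i k))

∑∑∑-rotate : ∀ n t → ∑∑∑ n (λ i j k → t j k i) ≡ ∑∑∑ n t
∑∑∑-rotate n t = trans (∑∑∑-swap₁₂ n (λ i j k → t i k j)) (∑∑∑-swap₂₃ n t)

∑∑∑-rotate⁻¹ : ∀ n t → ∑∑∑ n (λ i j k → t k i j) ≡ ∑∑∑ n t
∑∑∑-rotate⁻¹ n t = trans (∑∑∑-swap₂₃ n (λ i j k → t j i k)) (∑∑∑-swap₁₂ n t)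

∑∑∑-reverse : ∀ n t → ∑∑∑ n (λ i j k → t k j i) ≡ ∑∑∑ n t
∑∑∑-reverse n t = trans (∑∑∑-swap₁₂ n (λ i j k → t k i j)) (∑∑∑-rotate⁻¹ n t)

Distinct : ∀ {n} → Fin n → Fin n → Fin n → Set
Distinct i j k = i ≢ j × j ≢ k × i ≢ k

distinct? : ∀ {n} (i j k : Fin n) → Distinct i j k ⊎ ¬ Distinct i j k
distinct? i j k with i F.≟ j | j F.≟ k | i F.≟ k
... | yes p | _     | _     = inj₂ (λ d → proj₁ d p)
... | no _  | yes p | _     = inj₂ (λ d → proj₁ (proj₂ d) p)
... | no _  | no _  | yes p = inj₂ (λ d → proj₂ (proj₂ d) p)
... | no a  | no b  | no c  = inj₁ (a , b , c)

sorted : ∀ {n} → Fin n → Fin n → Fin n → ℕ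
sorted i j k = ind ((i <ᶠ j) ∧ (j <ᶠ k))

ordered : ∀ {n} → (Fin n → Fin n → Fin n → ℕ) → Fin n → Fin n → Fin n → ℕ
ordered t i j k = sorted i j k * t i j k

one-sorted-order : ∀ {n} {i j k : Fin n} → Distinct i j k →
  sorted i j k + (sorted i k j + (sorted j i k + (sorted j k i + (sorted k i j + sorted k j i)))) ≡ 1
one-sorted-order {i = i} {j} {k} (i≢j , j≢k , i≢k)
  rewrite <ᶠ-flip i j i≢j | <ᶠ-flip j k j≢k | <ᶠ-flip i k i≢k
  with i <ᶠ j in a | j <ᶠ k in b | i <ᶠ k in c
... | true  | true  | true  = refl
... | true  | true  | false = ⊥-elim (true≢false (trans (sym (<ᶠ-trans i j k a b)) c))
... | true  | false | true  = refl
... | true  | false | false = refl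
... | false | true  | true  = refl
... | false | true  | false = refl
... | false | false | true  = ⊥-elim (true≢false (trans (sym (<ᶠ-trans i k j c (trans (<ᶠ-flip j k j≢k) (cong not b)))) a))
... | false | false | false = refl

module FullySymmetric {n} (t : Fin n → Fin n → Fin n → ℕ)
  (t-swap₁₂ : ∀ i j k → t i j k ≡ t j i k) (t-swap₂₃ : ∀ i j k → t i j k ≡ t i k j)
  (t-degenerate : ∀ i j k → ¬ Distinct i j k → t i j k ≡ 0) where

  sum6 : Fin n → Fin n → Fin n → ℕ
  sum6 i j k = ordered t i j k + (ordered t i k j + (ordered t j i k +
               (ordered t j k i + (ordered t k i j + ordered t k j i))))

  split6 : ∀ i j k → t i j k ≡ sum6 i j k
  split6 i j k with distinct? i j k
  ... | inj₂ nd = trans (t-degenerate i j k nd) (sym (cong₂ _+_ (z i j k (λ d → d))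
        (cong₂ _+_ (z i k j (λ (a , b , c) → c , ≢-sym b , a))
        (cong₂ _+_ (z j i k (λ (a , b , c) → ≢-sym a , c , b))
        (cong₂ _+_ (z j k i (λ (a , b , c) → ≢-sym c , a , ≢-sym b))
        (cong₂ _+_ (z k i j (λ (a , b , c) → b , ≢-sym c , ≢-sym a))
                   (z k j i (λ (a , b , c) → ≢-sym b , ≢-sym a , ≢-sym c))))))))
    where
    z : ∀ x y w → (Distinct x y w → Distinct i j k) → ordered t x y w ≡ 0
    z x y w f = trans (cong (sorted x y w *_) (t-degenerate x y w (λ d → nd (f d)))) (NP.*-zeroʳ (sorted x y w))
  ... | inj₁ d = begin
    t i j k                ≡⟨ sym (NP.*-identityˡ (t i j k)) ⟩
    1 * t i j k            ≡⟨ cong (_* t i j k) (sym (one-sorted-order d)) ⟩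
    _                      ≡⟨ factor (sorted i j k) (sorted i k j) (sorted j i k) (sorted j k i) (sorted k i j) (sorted k j i) (t i j k) ⟩
    _                      ≡⟨ sym (cong (ordered t i j k +_) (cong₂ _+_ (cong (sorted i k j *_) e₁) (cong₂ _+_ (cong (sorted j i k *_) e₂)
                                (cong₂ _+_ (cong (sorted j k i *_) e₃) (cong₂ _+_ (cong (sorted k i j *_) e₄) (cong (sorted k j i *_) e₅)))))) ⟩
    sum6 i j k ∎
    where
    factor : ∀ a b c d e f x → (a + (b + (c + (d + (e + f))))) * x ≡ a * x + (b * x + (c * x + (d * x + (e * x + f * x))))
    factor = solve-∀
    e₁ : t i k j ≡ t i j k
    e₁ = sym (t-swap₂₃ i j k)
    e₂ : t j i k ≡ t i j k
    e₂ = sym (t-swap₁₂ i j k)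
    e₃ : t j k i ≡ t i j k
    e₃ = trans (sym (t-swap₂₃ j i k)) e₂
    e₄ : t k i j ≡ t i j k
    e₄ = trans (t-swap₁₂ k i j) e₁
    e₅ : t k j i ≡ t i j k
    e₅ = trans (t-swap₁₂ k j i) e₃

  ∑∑∑-fully-symmetric : ∑∑∑ n t ≡ 6 * ∑∑∑ n (ordered t)
  ∑∑∑-fully-symmetric = begin
    ∑∑∑ n t     ≡⟨ ∑∑∑-cong n split6 ⟩
    ∑∑∑ n sum6  ≡⟨ distribute ⟩
    S + (S₂₃ + (S₁₂ + (Sʳ + (Sʳ⁻¹ + Sʳᵉᵛ))))
      ≡⟨ cong (S +_) (cong₂ _+_ (∑∑∑-swap₂₃ n o) (cong₂ _+_ (∑∑∑-swap₁₂ n o)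
           (cong₂ _+_ (∑∑∑-rotate n o) (cong₂ _+_ (∑∑∑-rotate⁻¹ n o) (∑∑∑-reverse n o))))) ⟩
    S + (S + (S + (S + (S + S))))  ≡⟨ cong (λ z → S + (S + (S + (S + (S + z))))) (sym (NP.+-identityʳ S)) ⟩
    6 * S ∎
    where
    o = ordered t
    S = ∑∑∑ n o
    S₂₃ = ∑∑∑ n (λ i j k → o i k j)
    S₁₂ = ∑∑∑ n (λ i j k → o j i k)
    Sʳ = ∑∑∑ n (λ i j k → o j k i)
    Sʳ⁻¹ = ∑∑∑ n (λ i j k → o k i j)
    Sʳᵉᵛ = ∑∑∑ n (λ i j k → o k j i)
    distribute : ∑∑∑ n sum6 ≡ S + (S₂₃ + (S₁₂ + (Sʳ + (Sʳ⁻¹ + Sʳᵉᵛ))))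
    distribute =
      trans (∑∑∑-distrib-+ n _ _) (cong (S +_)
      (trans (∑∑∑-distrib-+ n _ _) (cong (S₂₃ +_)
      (trans (∑∑∑-distrib-+ n _ _) (cong (S₁₂ +_)
      (trans (∑∑∑-distrib-+ n _ _) (cong (Sʳ +_)
      (∑∑∑-distrib-+ n _ _))))))))

Adj : ℕ → Set
Adj n = Fin n → Fin n → Bool

Symmetric : ∀ {n} → Adj n → Set
Symmetric A = ∀ u v → A u v ≡ A v u

Irreflexive : ∀ {n} → Adj n → Set
Irreflexive A = ∀ u → A u u ≡ false

-- Invariants summed over ordered pairs and triples; for a graph G they are
-- 2 · edges G, M₁ G, 2 · M₂ G and 6 · k₃ G.
module _ {n : ℕ} (A : Adj n) where
  dg : Fin n → ℕ
  dg u = ∑ n (λ v → ind (A u v))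

  ordEdges : ℕ
  ordEdges = ∑ n dg

  sqDegSum : ℕ
  sqDegSum = ∑ n (λ u → dg u * dg u)

  ordM₂ : ℕ
  ordM₂ = ∑ n (λ u → ∑ n (λ v → ind (A u v) * (dg u * dg v)))

  triangleAt : Fin n → Fin n → Fin n → ℕ
  triangleAt i j k = ind (A i j ∧ A j k ∧ A i k)

  ordK₃ : ℕ
  ordK₃ = ∑∑∑ n triangleAt

∧₃-false : ∀ x y z → x ≡ false ⊎ y ≡ false ⊎ z ≡ false → (x ∧ y ∧ z) ≡ false
∧₃-false false y z _ = refl
∧₃-false true false z _ = refl
∧₃-false true true false _ = refl
∧₃-false true true true (inj₁ ())
∧₃-false true true true (inj₂ (inj₁ ()))
∧₃-false true true true (inj₂ (inj₂ ()))

triangleAt-degenerate : ∀ {n} (A : Adj n) → Irreflexive A → ∀ i j k → ¬ Distinct i j k → triangleAt A i j k ≡ 0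
triangleAt-degenerate A irr i j k nd with i F.≟ j | j F.≟ k | i F.≟ k
... | yes refl | _ | _ = cong ind (∧₃-false (A i i) (A i k) (A i k) (inj₁ (irr i)))
... | no _ | yes refl | _ = cong ind (∧₃-false (A i j) (A j j) (A i j) (inj₂ (inj₁ (irr j))))
... | no _ | no _ | yes refl = cong ind (∧₃-false (A i j) (A j i) (A i i) (inj₂ (inj₂ (irr i))))
... | no a | no b | no c = ⊥-elim (nd (a , b , c))

module Conversion {n} (G : Graph n) where
  private
    A = adj G

  ordEdges≡2*edges : ordEdges A ≡ 2 * edges G
  ordEdges≡2*edges =
    trans (∑∑-symmetric n (λ i j → ind (A i j)) (λ i j → cong ind (adj-sym G i j)) (λ i → cong ind (irrefl G i)))
          (cong (2 *_) (∑-cong n (λ i → ∑-cong n (λ j → sym (ind-∧ (i <ᶠ j) (A i j))))))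

  ordM₂≡2*M₂ : ordM₂ A ≡ 2 * M₂ G
  ordM₂≡2*M₂ =
    trans (∑∑-symmetric n (λ i j → ind (A i j) * (dg A i * dg A j))
            (λ i j → cong₂ _*_ (cong ind (adj-sym G i j)) (NP.*-comm (dg A i) (dg A j)))
            (λ i → cong (λ b → ind b * (dg A i * dg A i)) (irrefl G i)))
          (cong (2 *_) (∑-cong n (λ i → ∑-cong n (λ j → weight (i <ᶠ j) (A i j) (dg A i * dg A j)))))
    where
    weight : ∀ a b x → ind a * (ind b * x) ≡ (if a ∧ b then x else 0)
    weight true  true  x = trans (NP.+-identityʳ _) (NP.+-identityʳ x)
    weight true  false x = refl
    weight false b     x = refl

  ordK₃≡6*k₃ : ordK₃ A ≡ 6 * k₃ G
  ordK₃≡6*k₃ =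
    trans (FullySymmetric.∑∑∑-fully-symmetric (triangleAt A) swap₁₂ swap₂₃ (triangleAt-degenerate A (irrefl G)))
          (cong (6 *_) (∑∑∑-cong n (λ i j k → weight (i <ᶠ j) (j <ᶠ k) (A i j ∧ A j k ∧ A i k))))
    where
    weight : ∀ a b x → ind (a ∧ b) * ind x ≡ ind (a ∧ b ∧ x)
    weight true  true  x = NP.+-identityʳ (ind x)
    weight true  false x = refl
    weight false b     x = refl
    reorder : ∀ x y z → (x ∧ y ∧ z) ≡ (x ∧ z ∧ y)
    reorder x y z = cong (x ∧_) (∧-comm y z)
    swap₁₂ : ∀ i j k → triangleAt A i j k ≡ triangleAt A j i k
    swap₁₂ i j k = cong ind (trans (reorder (A i j) (A j k) (A i k)) (cong (λ w → w ∧ A i k ∧ A j k) (adj-sym G i j)))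
    swap₂₃ : ∀ i j k → triangleAt A i j k ≡ triangleAt A i k j
    swap₂₃ i j k = cong ind (trans (reverse (A i j) (A j k) (A i k)) (cong (λ w → A i k ∧ w ∧ A i j) (adj-sym G j k)))
      where
      reverse : ∀ x y z → (x ∧ y ∧ z) ≡ (z ∧ y ∧ x)
      reverse true  y true  = refl
      reverse true  y false = ∧-zeroʳ y
      reverse false y true  = sym (∧-zeroʳ y)
      reverse false y false = refl

-- Relabelling

infix 4 _≐_ _≃_

_≐_ : ∀ {n} → Adj n → Adj n → Set
A ≐ B = ∀ u v → A u v ≡ B u v

record _≃_ {n} (A B : Adj n) : Set where
  constructor relabelling
  field
    σ       : Permutation′ n
    relabel : ∀ u v → A u v ≡ B (σ ⟨$⟩ʳ u) (σ ⟨$⟩ʳ v)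

≃⇒≅ : ∀ {n} (G S : Graph n) → adj G ≃ adj S → G ≅ S
≃⇒≅ G S (relabelling σ h) = σ , h

≅⇒≃ : ∀ {n} (G S : Graph n) → G ≅ S → adj G ≃ adj S
≅⇒≃ G S (σ , h) = relabelling σ h

≐⇒≃ : ∀ {n} {A B : Adj n} → A ≐ B → A ≃ B
≐⇒≃ h = relabelling Perm.id h

≃-trans : ∀ {n} {A B C : Adj n} → A ≃ B → B ≃ C → A ≃ C
≃-trans (relabelling σ h) (relabelling τ k) = relabelling (σ ∘ₚ τ) (λ u v → trans (h u v) (k _ _))

≃-sym : ∀ {n} {A B : Adj n} → A ≃ B → B ≃ A
≃-sym {B = B} (relabelling σ h) = relabelling (Perm.flip σ) λ u v →
  trans (sym (cong₂ B (Perm.inverseʳ σ) (Perm.inverseʳ σ))) (sym (h _ _))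

≃-≐ : ∀ {n} {A B C : Adj n} → A ≃ B → B ≐ C → A ≃ C
≃-≐ iso h = ≃-trans iso (≐⇒≃ h)

≐-≃ : ∀ {n} {A B C : Adj n} → A ≐ B → B ≃ C → A ≃ C
≐-≃ h iso = ≃-trans (≐⇒≃ h) iso

module Relabel {n} {A B : Adj n} (iso : A ≃ B) where
  open _≃_ iso renaming (relabel to h)
  private
    s : Fin n → Fin n
    s u = σ ⟨$⟩ʳ u

  dg-≃ : ∀ u → dg A u ≡ dg B (s u)
  dg-≃ u = trans (∑-cong n (λ v → cong ind (h u v))) (∑-permute n σ (λ v → ind (B (s u) v)))

  ordEdges-≃ : ordEdges A ≡ ordEdges B
  ordEdges-≃ = trans (∑-cong n dg-≃) (∑-permute n σ (dg B))

  sqDegSum-≃ : sqDegSum A ≡ sqDegSum B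
  sqDegSum-≃ = trans (∑-cong n (λ u → cong₂ _*_ (dg-≃ u) (dg-≃ u))) (∑-permute n σ (λ u → dg B u * dg B u))

  ordM₂-≃ : ordM₂ A ≡ ordM₂ B
  ordM₂-≃ =
    trans (∑-cong n (λ u → trans (∑-cong n (λ v → cong₂ _*_ (cong ind (h u v)) (cong₂ _*_ (dg-≃ u) (dg-≃ v))))
                                 (∑-permute n σ (λ v → ind (B (s u) v) * (dg B (s u) * dg B v)))))
          (∑-permute n σ (λ u → ∑ n (λ v → ind (B u v) * (dg B u * dg B v))))

  ordK₃-≃ : ordK₃ A ≡ ordK₃ B
  ordK₃-≃ =
    trans (∑-cong n (λ i → trans (∑-cong n (λ j →
             trans (∑-cong n (λ k → cong ind (cong₂ _∧_ (h i j) (cong₂ _∧_ (h j k) (h i k)))))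
                   (∑-permute n σ (triangleAt B (s i) (s j)))))
             (∑-permute n σ (λ j → ∑ n (triangleAt B (s i) j)))))
          (∑-permute n σ (λ i → ∑ n (λ j → ∑ n (triangleAt B i j))))

open Relabel public




H-≃ : ∀ {n} (G S : Graph n) → adj G ≃ adj S → H G ≡ H S
H-≃ G S iso = cong₂ (λ a b → ℤ.+ a ℤ.- ℤ.+ b)
  (NP.*-cancelˡ-≡ (M₂ G) (M₂ S) 2 (trans (sym (ordM₂≡2*M₂ G)) (trans (ordM₂-≃ iso) (ordM₂≡2*M₂ S))))
  (trans (sym (ordK₃≡6*k₃ G)) (trans (ordK₃-≃ iso) (ordK₃≡6*k₃ S)))
  where open Conversion

-ℤ-< : ∀ a b c d → a + d < b + c → ℤ.+ a ℤ.- ℤ.+ c ℤ.< ℤ.+ b ℤ.- ℤ.+ d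
-ℤ-< a b c d lt = subst₂ ℤ._<_ (sym (as-⊖ a c d)) (sym (trans (as-⊖ b d c) (cong ((b + c) ⊖_) (NP.+-comm d c))))
  (ℤP.⊖-monoˡ-< (c + d) lt)
  where
  as-⊖ : ∀ x y z → ℤ.+ x ℤ.- ℤ.+ y ≡ (x + z) ⊖ (y + z)
  as-⊖ x y z = trans (ℤP.m-n≡m⊖n x y)
    (trans (sym (ℤP.+-cancelˡ-⊖ z x y)) (cong₂ _⊖_ (NP.+-comm z x) (NP.+-comm z y)))

H-< : ∀ {n} (G S : Graph n) →
  ordM₂ (adj G) + 2 * ordK₃ (adj S) < ordM₂ (adj S) + 2 * ordK₃ (adj G) → H G ℤ.< H S
H-< G S lt = -ℤ-< (M₂ G) (M₂ S) (6 * k₃ G) (6 * k₃ S) (NP.*-cancelˡ-< 2 _ _ (subst₂ _<_ (double G S) (double S G) lt))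
  where
  open Conversion
  double : ∀ X Y → ordM₂ (adj X) + 2 * ordK₃ (adj Y) ≡ 2 * (M₂ X + 6 * k₃ Y)
  double X Y = trans (cong₂ (λ a b → a + 2 * b) (ordM₂≡2*M₂ X) (ordK₃≡6*k₃ Y)) (sym (NP.*-distribˡ-+ 2 (M₂ X) _))

Assignment : ℕ → Set
Assignment n = List (Fin n × Fin n)

Injective : ∀ {n} → Assignment n → Set
Injective [] = ⊤
Injective ((a , b) ∷ ps) = All (λ (a′ , b′) → a ≢ a′ × b ≢ b′) ps × Injective ps

Realises : ∀ {n} → Permutation′ n → Assignment n → Set
Realises σ ps = All (λ (a , b) → σ ⟨$⟩ʳ a ≡ b) ps

permutation-injective : ∀ {n} (σ : Permutation′ n) {x y} → σ ⟨$⟩ʳ x ≡ σ ⟨$⟩ʳ y → x ≡ y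
permutation-injective σ e = trans (sym (Perm.inverseˡ σ)) (trans (cong (σ ⟨$⟩ˡ_) e) (Perm.inverseˡ σ))

-- Realised one pair at a time: after σ′ handles the tail, a transposition sends σ′ a to b
-- without disturbing the targets of the tail, which all differ from b.
extend : ∀ {n} (ps : Assignment n) → Injective ps → Σ (Permutation′ n) (λ σ → Realises σ ps)
extend [] _ = Perm.id , []
extend ((a , b) ∷ ps) (fresh , inj) with extend ps inj
... | σ′ , realised = σ′ ∘ₚ Perm.transpose (σ′ ⟨$⟩ʳ a) b , transpose-hit (σ′ ⟨$⟩ʳ a) b ∷ keep ps fresh realised
  where
  transpose-hit : ∀ {n} (i j : Fin n) → Perm.transpose i j ⟨$⟩ʳ i ≡ j
  transpose-hit i j with i F.≟ i
  ... | yes _ = refl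
  ... | no ne = ⊥-elim (ne refl)
  transpose-miss : ∀ {n} (i j k : Fin n) → k ≢ i → k ≢ j → Perm.transpose i j ⟨$⟩ʳ k ≡ k
  transpose-miss i j k ni nj with k F.≟ i
  ... | yes e = ⊥-elim (ni e)
  ... | no _ with k F.≟ j
  ...   | yes e = ⊥-elim (nj e)
  ...   | no _ = refl
  keep : ∀ qs → All (λ (a′ , b′) → a ≢ a′ × b ≢ b′) qs → Realises σ′ qs →
         Realises (σ′ ∘ₚ Perm.transpose (σ′ ⟨$⟩ʳ a) b) qs
  keep [] [] [] = []
  keep ((a′ , b′) ∷ qs) ((na , nb) ∷ fr) (e ∷ m) =
    trans (cong (Perm.transpose (σ′ ⟨$⟩ʳ a) b ⟨$⟩ʳ_) e)
          (transpose-miss (σ′ ⟨$⟩ʳ a) b b′ (λ q → na (permutation-injective σ′ (trans (sym q) (sym e)))) (≢-sym nb))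
    ∷ keep qs fr m

-- Complements

compl : ∀ {n} → Adj n → Adj n
compl A u v = not (A u v) ∧ not (u == v)

compl-sym : ∀ {n} (A : Adj n) → Symmetric A → Symmetric (compl A)
compl-sym A sym-A u v = cong₂ (λ a b → not a ∧ not b) (sym-A u v) (==-sym u v)

compl-irrefl : ∀ {n} (A : Adj n) → Irreflexive (compl A)
compl-irrefl A u = trans (cong (λ b → not (A u u) ∧ not b) (==-refl u)) (∧-zeroʳ _)

compl-≢ : ∀ {n} (A : Adj n) {u v} → u ≢ v → compl A u v ≡ not (A u v)
compl-≢ A ne = trans (cong (λ b → not (A _ _) ∧ not b) (==-≢ ne)) (∧-identityʳ _)

compl-involutive : ∀ {n} (A : Adj n) → Irreflexive A → compl (compl A) ≐ A
compl-involutive A irr u v with ≡-or-≢ u v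
... | inj₁ refl = trans (compl-irrefl (compl A) u) (sym (irr u))
... | inj₂ ne = trans (compl-≢ (compl A) ne) (trans (cong not (compl-≢ A ne)) (not-involutive (A u v)))

compl-≃ : ∀ {n} {A B : Adj n} → A ≃ B → compl A ≃ compl B
compl-≃ (relabelling σ h) = relabelling σ λ u v → cong₂ (λ a b → not a ∧ not b) (h u v) (sym (relabel-== u v))
  where
  relabel-== : ∀ u v → ((σ ⟨$⟩ʳ u) == (σ ⟨$⟩ʳ v)) ≡ (u == v)
  relabel-== u v with u F.≟ v
  ... | yes refl = ==-refl (σ ⟨$⟩ʳ u)
  ... | no ne = ==-≢ (λ e → ne (permutation-injective σ e))

partition : ∀ {n} (A : Adj n) → Irreflexive A → ∀ u v → ind (A u v) + ind (compl A u v) + δ u v ≡ 1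
partition A irr u v with v F.≟ u
... | yes refl rewrite irr v | ==-refl v = refl
... | no ne rewrite ==-≢ (≢-sym ne) with A u v
...   | true  = refl
...   | false = refl

dg-compl : ∀ {n} (A : Adj n) → Irreflexive A → ∀ u → dg A u + dg (compl A) u + 1 ≡ n
dg-compl {n} A irr u = begin
  dg A u + dg (compl A) u + 1
    ≡⟨ cong₂ _+_ (sym (∑-distrib-+ n (λ v → ind (A u v)) (λ v → ind (compl A u v)))) (sym (∑-δ-one n u)) ⟩
  ∑ n (λ v → ind (A u v) + ind (compl A u v)) + ∑ n (δ u)
    ≡⟨ sym (∑-distrib-+ n (λ v → ind (A u v) + ind (compl A u v)) (δ u)) ⟩
  ∑ n (λ v → ind (A u v) + ind (compl A u v) + δ u v)
    ≡⟨ ∑-cong n (partition A irr u) ⟩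
  ∑ n (λ _ → 1)
    ≡⟨ trans (∑-const n 1) (NP.*-identityʳ n) ⟩
  n ∎

module Complement {N : ℕ} (A : Adj (suc N)) (sym-A : Symmetric A) (irr-A : Irreflexive A) where
  private
    n = suc N
    Ā = compl A
    a ā : Fin n → Fin n → ℕ
    a u v = ind (A u v)
    ā u v = ind (Ā u v)
    d d̄ : Fin n → ℕ
    d = dg A
    d̄ = dg Ā

    ∑∑ : (Fin n → Fin n → ℕ) → ℕ
    ∑∑ g = ∑ n (λ u → ∑ n (λ v → g u v))

    ∑∑-cong : ∀ {f g} → (∀ u v → f u v ≡ g u v) → ∑∑ f ≡ ∑∑ g
    ∑∑-cong h = ∑-cong n (λ u → ∑-cong n (h u))

    ∑∑-distrib-+ : ∀ f g → ∑∑ (λ u v → f u v + g u v) ≡ ∑∑ f + ∑∑ g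
    ∑∑-distrib-+ f g = trans (∑-cong n (λ u → ∑-distrib-+ n (f u) (g u)))
                              (∑-distrib-+ n (λ u → ∑ n (f u)) (λ u → ∑ n (g u)))

    ∑∑-adjacent : ∀ (f : Fin n → ℕ) → ∑∑ (λ u v → a u v * f u) ≡ ∑ n (λ u → d u * f u)
    ∑∑-adjacent f = ∑-cong n (λ u → ∑-*ʳ n (f u) (a u))

  d+d̄ : ∀ u → d u + d̄ u ≡ N
  d+d̄ u = NP.suc-injective (trans (NP.+-comm 1 _) (dg-compl A irr-A u))

  ordEdges-compl : ordEdges A + ordEdges Ā + n ≡ n * n
  ordEdges-compl = begin
    ordEdges A + ordEdges Ā + n
      ≡⟨ cong₂ _+_ (sym (∑-distrib-+ n d d̄)) (sym (trans (∑-const n 1) (NP.*-identityʳ n))) ⟩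
    ∑ n (λ u → d u + d̄ u) + ∑ n (λ _ → 1)
      ≡⟨ sym (∑-distrib-+ n (λ u → d u + d̄ u) (λ _ → 1)) ⟩
    ∑ n (λ u → d u + d̄ u + 1)
      ≡⟨ trans (∑-cong n (dg-compl A irr-A)) (∑-const n n) ⟩
    n * n ∎

  sqDegSum-compl : sqDegSum A + 2 * N * ordEdges Ā ≡ n * (N * N) + sqDegSum Ā
  sqDegSum-compl = begin
    sqDegSum A + 2 * N * ordEdges Ā
      ≡⟨ cong (sqDegSum A +_) (sym (∑-*ˡ n (2 * N) d̄)) ⟩
    sqDegSum A + ∑ n (λ u → 2 * N * d̄ u)
      ≡⟨ sym (∑-distrib-+ n (λ u → d u * d u) (λ u → 2 * N * d̄ u)) ⟩
    ∑ n (λ u → d u * d u + 2 * N * d̄ u)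
      ≡⟨ ∑-cong n pointwise ⟩
    ∑ n (λ u → N * N + d̄ u * d̄ u)
      ≡⟨ trans (∑-distrib-+ n (λ _ → N * N) (λ u → d̄ u * d̄ u)) (cong (_+ sqDegSum Ā) (∑-const n (N * N))) ⟩
    n * (N * N) + sqDegSum Ā ∎
    where
    square : ∀ x y → x * x + 2 * (x + y) * y ≡ (x + y) * (x + y) + y * y
    square = solve-∀
    pointwise : ∀ u → d u * d u + 2 * N * d̄ u ≡ N * N + d̄ u * d̄ u
    pointwise u = trans (cong (λ m → d u * d u + 2 * m * d̄ u) (sym (d+d̄ u)))
                 (trans (square (d u) (d̄ u)) (cong (λ m → m * m + d̄ u * d̄ u) (d+d̄ u)))

  -- Splitting ∑∑ d̄ᵤ d̄ᵥ = (∑ d̄)² along the partition of the ordered pairs.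
  ordM₂-compl-step : ordM₂ Ā + ∑∑ (λ u v → a u v * (d̄ u * d̄ v)) + sqDegSum Ā ≡ ordEdges Ā * ordEdges Ā
  ordM₂-compl-step = begin
    ordM₂ Ā + ∑∑ (λ u v → a u v * X u v) + sqDegSum Ā
      ≡⟨ cong (ordM₂ Ā + ∑∑ (λ u v → a u v * X u v) +_) (sym (∑-cong n (λ u → ∑-δ n u (λ v → d̄ u * d̄ v)))) ⟩
    ordM₂ Ā + ∑∑ (λ u v → a u v * X u v) + ∑∑ (λ u v → δ u v * X u v)
      ≡⟨ sym (trans (∑∑-distrib-+ (λ u v → ā u v * X u v + a u v * X u v) (λ u v → δ u v * X u v))
               (cong (_+ ∑∑ (λ u v → δ u v * X u v)) (∑∑-distrib-+ (λ u v → ā u v * X u v) (λ u v → a u v * X u v)))) ⟩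
    ∑∑ (λ u v → ā u v * X u v + a u v * X u v + δ u v * X u v)
      ≡⟨ ∑∑-cong (λ u v → trans (factor (ā u v) (a u v) (δ u v) (X u v))
                   (trans (cong (_* X u v) (trans (cong (_+ δ u v) (NP.+-comm (ā u v) (a u v))) (partition A irr-A u v)))
                          (NP.*-identityˡ (X u v)))) ⟩
    ∑∑ X
      ≡⟨ ∑∑-product n d̄ d̄ ⟩
    ordEdges Ā * ordEdges Ā ∎
    where
    X : Fin n → Fin n → ℕ
    X u v = d̄ u * d̄ v
    factor : ∀ p q r x → p * x + q * x + r * x ≡ (p + q + r) * x
    factor = solve-∀

  cross : ℕ
  cross = ∑∑ (λ u v → a u v * (d u * d̄ v))

  ordM₂-expand : ordM₂ A + 2 * cross + ∑∑ (λ u v → a u v * (d̄ u * d̄ v)) ≡ N * N * ordEdges A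
  ordM₂-expand = begin
    ordM₂ A + 2 * cross + P
      ≡⟨ cong (λ z → ordM₂ A + (cross + z) + P) (trans (NP.+-identityʳ cross) (sym mirror)) ⟩
    ordM₂ A + (cross + ∑∑ (λ u v → a u v * (d̄ u * d v))) + P
      ≡⟨ sym (combine (ordM₂ A) cross _ P) ⟩
    ∑∑ t₁ + ∑∑ t₂ + ∑∑ t₃ + ∑∑ t₄
      ≡⟨ sym (trans (∑∑-distrib-+ (λ u v → t₁ u v + t₂ u v + t₃ u v) t₄) (cong (_+ ∑∑ t₄)
           (trans (∑∑-distrib-+ (λ u v → t₁ u v + t₂ u v) t₃) (cong (_+ ∑∑ t₃) (∑∑-distrib-+ t₁ t₂))))) ⟩
    ∑∑ (λ u v → t₁ u v + t₂ u v + t₃ u v + t₄ u v)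
      ≡⟨ ∑∑-cong (λ u v → trans (expand (a u v) (d u) (d̄ u) (d v) (d̄ v)) (cong₂ (λ x y → a u v * (x * y)) (d+d̄ u) (d+d̄ v))) ⟩
    ∑∑ (λ u v → a u v * (N * N))
      ≡⟨ trans (∑∑-adjacent (λ _ → N * N)) (trans (∑-*ʳ n (N * N) d) (NP.*-comm _ (N * N))) ⟩
    N * N * ordEdges A ∎
    where
    t₁ t₂ t₃ t₄ : Fin n → Fin n → ℕ
    t₁ u v = a u v * (d u * d v)
    t₂ u v = a u v * (d u * d̄ v)
    t₃ u v = a u v * (d̄ u * d v)
    t₄ u v = a u v * (d̄ u * d̄ v)
    P = ∑∑ t₄
    combine : ∀ w x y z → w + x + y + z ≡ w + (x + y) + z
    combine = solve-∀
    expand : ∀ e x x̄ y ȳ → e * (x * y) + e * (x * ȳ) + e * (x̄ * y) + e * (x̄ * ȳ) ≡ e * ((x + x̄) * (y + ȳ))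
    expand = solve-∀
    mirror : ∑∑ (λ u v → a u v * (d̄ u * d v)) ≡ cross
    mirror = trans (∑-swap n n (λ u v → a u v * (d̄ u * d v)))
                   (∑∑-cong (λ u v → cong₂ _*_ (cong ind (sym-A v u)) (NP.*-comm (d̄ v) (d u))))

  ordM₂-cross : ordM₂ A + cross ≡ N * sqDegSum A
  ordM₂-cross = begin
    ordM₂ A + cross
      ≡⟨ sym (∑∑-distrib-+ (λ u v → a u v * (d u * d v)) (λ u v → a u v * (d u * d̄ v))) ⟩
    ∑∑ (λ u v → a u v * (d u * d v) + a u v * (d u * d̄ v))
      ≡⟨ ∑∑-cong (λ u v → trans (expand (a u v) (d u) (d v) (d̄ v)) (cong (λ y → a u v * (d u * y)) (d+d̄ v))) ⟩
    ∑∑ (λ u v → a u v * (d u * N))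
      ≡⟨ trans (∑∑-adjacent (λ u → d u * N)) (∑-cong n (λ u → reassoc (d u) N)) ⟩
    ∑ n (λ u → N * (d u * d u))
      ≡⟨ ∑-*ˡ n N (λ u → d u * d u) ⟩
    N * sqDegSum A ∎
    where
    expand : ∀ e x y ȳ → e * (x * y) + e * (x * ȳ) ≡ e * (x * (y + ȳ))
    expand = solve-∀
    reassoc : ∀ x m → x * (x * m) ≡ m * (x * x)
    reassoc = solve-∀

  ordM₂-sum : ordM₂ A + ordM₂ Ā + sqDegSum Ā + N * N * ordEdges A ≡ ordEdges Ā * ordEdges Ā + 2 * (N * sqDegSum A)
  ordM₂-sum = begin
    ordM₂ A + ordM₂ Ā + sqDegSum Ā + N * N * ordEdges A
      ≡⟨ cong (ordM₂ A + ordM₂ Ā + sqDegSum Ā +_) (sym ordM₂-expand) ⟩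
    ordM₂ A + ordM₂ Ā + sqDegSum Ā + (ordM₂ A + 2 * cross + P)
      ≡⟨ regroup (ordM₂ A) (ordM₂ Ā) (sqDegSum Ā) cross P ⟩
    (ordM₂ Ā + P + sqDegSum Ā) + 2 * (ordM₂ A + cross)
      ≡⟨ cong₂ (λ x y → x + 2 * y) ordM₂-compl-step ordM₂-cross ⟩
    ordEdges Ā * ordEdges Ā + 2 * (N * sqDegSum A) ∎
    where
    P = ∑∑ (λ u v → a u v * (d̄ u * d̄ v))
    regroup : ∀ x y s c p → x + y + s + (x + 2 * c + p) ≡ (y + p + s) + 2 * (x + c)
    regroup = solve-∀

  disjoint : ∀ u v → a u v * ā u v ≡ 0
  disjoint u v with A u v
  ... | true  = refl
  ... | false = refl

  -- Colouring each pair by A or by its complement, mixed u v w = 1 iff u sees v and w in different colours.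
  mixed : Fin n → Fin n → Fin n → ℕ
  mixed u v w = a u v * ā u w + ā u v * a u w

  mixed-degenerate : ∀ u v w → ¬ Distinct u v w → mixed u v w ≡ 0
  mixed-degenerate u v w nd with ≡-or-≢ u v | ≡-or-≢ v w | ≡-or-≢ u w
  ... | inj₁ refl | _ | _ rewrite irr-A u | ==-refl u = refl
  ... | inj₂ _ | inj₁ refl | _ = cong₂ _+_ (disjoint u v) (trans (NP.*-comm (ā u v) (a u v)) (disjoint u v))
  ... | inj₂ _ | inj₂ _ | inj₁ refl rewrite irr-A u | ==-refl u =
        cong₂ _+_ (NP.*-zeroʳ (a u v)) (NP.*-zeroʳ (ā u v))
  ... | inj₂ p | inj₂ q | inj₂ r = ⊥-elim (nd (p , q , r))

  distinctInd : Fin n → Fin n → Fin n → ℕ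
  distinctInd i j k = ind (not (i == j) ∧ not (j == k) ∧ not (i == k))

  -- In a two-coloured triangle exactly two corners see the other two corners in different colours.
  colour-count : ∀ i j k →
    2 * (triangleAt A i j k + triangleAt Ā i j k) + (mixed j i k + mixed i j k + mixed k i j) ≡ 2 * distinctInd i j k
  colour-count i j k with distinct? i j k
  ... | inj₂ nd = sym (trans (cong (2 *_) (distinctInd-degenerate nd)) (sym (cong₂ _+_
        (cong (2 *_) (cong₂ _+_ (triangleAt-degenerate A irr-A i j k nd) (triangleAt-degenerate Ā (compl-irrefl A) i j k nd)))
        (cong₂ _+_ (cong₂ _+_ (mixed-degenerate j i k (λ (p , q , r) → nd (≢-sym p , r , q))) (mixed-degenerate i j k nd))
                   (mixed-degenerate k i j (λ (p , q , r) → nd (q , ≢-sym r , ≢-sym p)))))))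
    where
    distinctInd-degenerate : ¬ Distinct i j k → distinctInd i j k ≡ 0
    distinctInd-degenerate nd with ≡-or-≢ i j | ≡-or-≢ j k | ≡-or-≢ i k
    ... | inj₁ refl | _ | _ rewrite ==-refl i = refl
    ... | inj₂ _ | inj₁ refl | _ rewrite ==-refl j = cong ind (∧-zeroʳ (not (i == j)))
    ... | inj₂ _ | inj₂ _ | inj₁ refl rewrite ==-refl i = cong ind (trans (cong (not (i == j) ∧_) (∧-zeroʳ _)) (∧-zeroʳ _))
    ... | inj₂ p | inj₂ q | inj₂ r = ⊥-elim (nd (p , q , r))
  ... | inj₁ (i≢j , j≢k , i≢k)
    rewrite compl-≢ A i≢j | compl-≢ A j≢k | compl-≢ A i≢k
          | compl-≢ A (≢-sym i≢j) | compl-≢ A (≢-sym j≢k) | compl-≢ A (≢-sym i≢k)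
          | sym-A j i | sym-A k j | sym-A k i | ==-≢ i≢j | ==-≢ j≢k | ==-≢ i≢k
    = two-colours (A i j) (A j k) (A i k)
    where
    two-colours : ∀ x y z →
      2 * (ind (x ∧ y ∧ z) + ind (not x ∧ not y ∧ not z)) +
      ((ind x * ind (not y) + ind (not x) * ind y) + (ind x * ind (not z) + ind (not x) * ind z)
        + (ind z * ind (not y) + ind (not z) * ind y)) ≡ 2
    two-colours true  true  true  = refl
    two-colours true  true  false = refl
    two-colours true  false true  = refl
    two-colours true  false false = refl
    two-colours false true  true  = refl
    two-colours false true  false = refl
    two-colours false false true  = refl
    two-colours false false false = refl

  mixedDeg : ℕ
  mixedDeg = ∑ n (λ u → d u * d̄ u)

  ∑∑∑-mixed : ∑∑∑ n mixed ≡ 2 * mixedDeg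
  ∑∑∑-mixed = begin
    ∑∑∑ n mixed
      ≡⟨ ∑-cong n (λ u → trans (∑∑-distrib-+ (λ v w → a u v * ā u w) (λ v w → ā u v * a u w))
                                (cong₂ _+_ (∑∑-product n (a u) (ā u)) (∑∑-product n (ā u) (a u)))) ⟩
    ∑ n (λ u → d u * d̄ u + d̄ u * d u)
      ≡⟨ ∑-cong n (λ u → trans (cong (d u * d̄ u +_) (trans (NP.*-comm (d̄ u) (d u)) (sym (NP.+-identityʳ _)))) refl) ⟩
    ∑ n (λ u → 2 * (d u * d̄ u))
      ≡⟨ ∑-*ˡ n 2 (λ u → d u * d̄ u) ⟩
    2 * mixedDeg ∎

  ordK₃-sum : 2 * (ordK₃ A + ordK₃ Ā) + 3 * (2 * mixedDeg) ≡ 2 * ∑∑∑ n distinctInd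
  ordK₃-sum = begin
    2 * (ordK₃ A + ordK₃ Ā) + 3 * (2 * mixedDeg)
      ≡⟨ cong₂ _+_ (cong (2 *_) (sym (∑∑∑-distrib-+ n (triangleAt A) (triangleAt Ā))))
                   (sym (trans (cong₂ _+_ (cong₂ _+_ (∑∑∑-swap₁₂ n mixed) refl) (∑∑∑-rotate⁻¹ n mixed))
                               (trans (cong₂ (λ x y → x + y + y) ∑∑∑-mixed ∑∑∑-mixed) (thrice (2 * mixedDeg))))) ⟩
    2 * ∑∑∑ n (λ i j k → triangleAt A i j k + triangleAt Ā i j k)
      + (∑∑∑ n (λ i j k → mixed j i k) + ∑∑∑ n mixed + ∑∑∑ n (λ i j k → mixed k i j))
      ≡⟨ cong₂ _+_ (sym (∑∑∑-*ˡ n 2 (λ i j k → triangleAt A i j k + triangleAt Ā i j k))) (sym (trans (∑∑∑-distrib-+ n (λ i j k → mixed j i k + mixed i j k) (λ i j k → mixed k i j))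
                                               (cong (_+ ∑∑∑ n (λ i j k → mixed k i j)) (∑∑∑-distrib-+ n (λ i j k → mixed j i k) mixed)))) ⟩
    ∑∑∑ n (λ i j k → 2 * (triangleAt A i j k + triangleAt Ā i j k))
      + ∑∑∑ n (λ i j k → mixed j i k + mixed i j k + mixed k i j)
      ≡⟨ sym (∑∑∑-distrib-+ n (λ i j k → 2 * (triangleAt A i j k + triangleAt Ā i j k))
                               (λ i j k → mixed j i k + mixed i j k + mixed k i j)) ⟩
    ∑∑∑ n (λ i j k → 2 * (triangleAt A i j k + triangleAt Ā i j k) + (mixed j i k + mixed i j k + mixed k i j))
      ≡⟨ ∑∑∑-cong n colour-count ⟩
    ∑∑∑ n (λ i j k → 2 * distinctInd i j k)
      ≡⟨ ∑∑∑-*ˡ n 2 distinctInd ⟩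
    2 * ∑∑∑ n distinctInd ∎
    where
    thrice : ∀ x → x + x + x ≡ 3 * x
    thrice = solve-∀

  mixedDeg-sum : mixedDeg + sqDegSum A ≡ N * ordEdges A
  mixedDeg-sum = begin
    mixedDeg + sqDegSum A
      ≡⟨ sym (∑-distrib-+ n (λ u → d u * d̄ u) (λ u → d u * d u)) ⟩
    ∑ n (λ u → d u * d̄ u + d u * d u)
      ≡⟨ ∑-cong n (λ u → trans (sym (NP.*-distribˡ-+ (d u) (d̄ u) (d u)))
                      (trans (cong (d u *_) (trans (NP.+-comm (d̄ u) (d u)) (d+d̄ u))) (NP.*-comm (d u) N))) ⟩
    ∑ n (λ u → N * d u)
      ≡⟨ ∑-*ˡ n N d ⟩
    N * ordEdges A ∎

module _ {N : ℕ} {A B : Adj (suc N)} (sym-A : Symmetric A) (irr-A : Irreflexive A)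
         (sym-B : Symmetric B) (irr-B : Irreflexive B)
         (ordEdges-eq : ordEdges A ≡ ordEdges B) (sqDegSum-eq : sqDegSum A ≡ sqDegSum B) where
  private
    module CA = Complement A sym-A irr-A
    module CB = Complement B sym-B irr-B

  ordEdges-compl-eq : ordEdges (compl A) ≡ ordEdges (compl B)
  ordEdges-compl-eq = NP.+-cancelˡ-≡ (ordEdges B) _ _ (NP.+-cancelʳ-≡ (suc N) _ _
    (trans (cong (λ e → e + ordEdges (compl A) + suc N) (sym ordEdges-eq))
           (trans CA.ordEdges-compl (sym CB.ordEdges-compl))))

  sqDegSum-compl-eq : sqDegSum (compl A) ≡ sqDegSum (compl B)
  sqDegSum-compl-eq = NP.+-cancelˡ-≡ (suc N * (N * N)) _ _
    (trans (sym CA.sqDegSum-compl)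
           (trans (cong₂ (λ q e → q + 2 * N * e) sqDegSum-eq ordEdges-compl-eq) CB.sqDegSum-compl))

  ordM₂-compl-sum : ordM₂ A + ordM₂ (compl A) ≡ ordM₂ B + ordM₂ (compl B)
  ordM₂-compl-sum = NP.+-cancelʳ-≡ (sqDegSum (compl A)) _ _ (NP.+-cancelʳ-≡ (N * N * ordEdges A) _ _ (begin
    ordM₂ A + ordM₂ (compl A) + sqDegSum (compl A) + N * N * ordEdges A
      ≡⟨ CA.ordM₂-sum ⟩
    ordEdges (compl A) * ordEdges (compl A) + 2 * (N * sqDegSum A)
      ≡⟨ cong₂ (λ e q → e * e + 2 * (N * q)) ordEdges-compl-eq sqDegSum-eq ⟩
    ordEdges (compl B) * ordEdges (compl B) + 2 * (N * sqDegSum B)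
      ≡⟨ sym CB.ordM₂-sum ⟩
    ordM₂ B + ordM₂ (compl B) + sqDegSum (compl B) + N * N * ordEdges B
      ≡⟨ cong₂ (λ s e → ordM₂ B + ordM₂ (compl B) + s + N * N * e) (sym sqDegSum-compl-eq) (sym ordEdges-eq) ⟩
    ordM₂ B + ordM₂ (compl B) + sqDegSum (compl A) + N * N * ordEdges A ∎))

  ordK₃-compl-sum : ordK₃ A + ordK₃ (compl A) ≡ ordK₃ B + ordK₃ (compl B)
  ordK₃-compl-sum = NP.*-cancelˡ-≡ _ _ 2 (NP.+-cancelʳ-≡ (3 * (2 * CA.mixedDeg)) _ _ (begin
    2 * (ordK₃ A + ordK₃ (compl A)) + 3 * (2 * CA.mixedDeg)  ≡⟨ trans CA.ordK₃-sum (sym CB.ordK₃-sum) ⟩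
    2 * (ordK₃ B + ordK₃ (compl B)) + 3 * (2 * CB.mixedDeg)  ≡⟨ cong (λ w → 2 * (ordK₃ B + ordK₃ (compl B)) + 3 * (2 * w)) (sym mixedDeg-eq) ⟩
    2 * (ordK₃ B + ordK₃ (compl B)) + 3 * (2 * CA.mixedDeg)  ∎))
    where
    mixedDeg-eq : CA.mixedDeg ≡ CB.mixedDeg
    mixedDeg-eq = NP.+-cancelʳ-≡ (sqDegSum A) _ _
      (trans CA.mixedDeg-sum (trans (cong (N *_) ordEdges-eq) (trans (sym CB.mixedDeg-sum) (cong (CB.mixedDeg +_) (sym sqDegSum-eq)))))

-- Graphs with at most three edges

ind-∨ : ∀ a b → (a ∧ b) ≡ false → ind (a ∨ b) ≡ ind a + ind b
ind-∨ true  false _ = refl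
ind-∨ true  true  ()
ind-∨ false b     _ = refl

edge : ∀ {n} → Fin n → Fin n → Adj n
edge x y u v = (u == x ∧ v == y) ∨ (u == y ∧ v == x)

edge-sym : ∀ {n} (x y : Fin n) → Symmetric (edge x y)
edge-sym x y u v = trans (∨-comm (u == x ∧ v == y) (u == y ∧ v == x))
  (cong₂ _∨_ (∧-comm (u == y) (v == x)) (∧-comm (u == x) (v == y)))

edge-flip : ∀ {n} (x y : Fin n) → edge x y ≐ edge y x
edge-flip x y u v = ∨-comm (u == x ∧ v == y) (u == y ∧ v == x)

edge-self : ∀ {n} (x y : Fin n) → edge x y x y ≡ true
edge-self x y rewrite ==-refl x | ==-refl y = refl

edge-ends : ∀ {n} {x y u v : Fin n} → edge x y u v ≡ true → (u ≡ x × v ≡ y) ⊎ (u ≡ y × v ≡ x)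
edge-ends {x = x} {y} {u} {v} e with u == x in ux | v == y in vy | u == y in uy | v == x in vx
... | true  | true  | _     | _    = inj₁ (==⇒≡ ux , ==⇒≡ vy)
... | true  | false | true  | true = inj₂ (==⇒≡ uy , ==⇒≡ vx)
... | false | _     | true  | true = inj₂ (==⇒≡ uy , ==⇒≡ vx)

dg-edge : ∀ {n} {x y : Fin n} → x ≢ y → ∀ u → dg (edge x y) u ≡ δ x u + δ y u
dg-edge {n} {x} {y} x≢y u = begin
  ∑ n (λ v → ind (edge x y u v))                          ≡⟨ ∑-cong n (λ v → ind-∨ (u == x ∧ v == y) (u == y ∧ v == x) (exclusive v)) ⟩
  ∑ n (λ v → ind (u == x ∧ v == y) + ind (u == y ∧ v == x)) ≡⟨ ∑-cong n (λ v → cong₂ _+_ (ind-∧ (u == x) (v == y)) (ind-∧ (u == y) (v == x))) ⟩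
  ∑ n (λ v → δ x u * δ y v + δ y u * δ x v)               ≡⟨ ∑-distrib-+ n (λ v → δ x u * δ y v) (λ v → δ y u * δ x v) ⟩
  ∑ n (λ v → δ x u * δ y v) + ∑ n (λ v → δ y u * δ x v)   ≡⟨ cong₂ _+_ (∑-*ˡ n (δ x u) (δ y)) (∑-*ˡ n (δ y u) (δ x)) ⟩
  δ x u * ∑ n (δ y) + δ y u * ∑ n (δ x)                   ≡⟨ cong₂ (λ a b → δ x u * a + δ y u * b) (∑-δ-one n y) (∑-δ-one n x) ⟩
  δ x u * 1 + δ y u * 1                                   ≡⟨ cong₂ _+_ (NP.*-identityʳ (δ x u)) (NP.*-identityʳ (δ y u)) ⟩
  δ x u + δ y u                                           ∎
  where
  exclusive : ∀ v → ((u == x ∧ v == y) ∧ (u == y ∧ v == x)) ≡ false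
  exclusive v with u == x in ux | u == y in uy
  ... | true  | true  = ⊥-elim (x≢y (trans (sym (==⇒≡ {x = u} ux)) (==⇒≡ {x = u} uy)))
  ... | true  | false = ∧-zeroʳ (v == y)
  ... | false | _     = refl

δ-pair≤1 : ∀ {n} {a b : Fin n} → a ≢ b → ∀ u → δ a u + δ b u ≤ 1
δ-pair≤1 {a = a} {b} a≢b u with ≡-or-≢ u a | ≡-or-≢ u b
... | inj₁ refl | inj₁ refl = ⊥-elim (a≢b refl)
... | inj₁ refl | inj₂ ne = NP.≤-reflexive (cong₂ _+_ (δ-self u) (δ-≢ ne))
... | inj₂ ne | inj₁ refl = NP.≤-reflexive (cong₂ _+_ (δ-≢ ne) (δ-self u))
... | inj₂ ne | inj₂ ne′ = NP.≤-trans (NP.≤-reflexive (cong₂ _+_ (δ-≢ ne) (δ-≢ ne′))) z≤n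

square-add : ∀ d a b → a + b ≤ 1 → (d + (a + b)) * (d + (a + b)) ≡ d * d + 2 * (d * a + d * b) + (a + b)
square-add d 0 0 _ = expand d
  where
  expand : ∀ d → (d + 0) * (d + 0) ≡ d * d + 2 * (d * 0 + d * 0) + 0
  expand = solve-∀
square-add d 0 1 _ = expand d
  where
  expand : ∀ d → (d + 1) * (d + 1) ≡ d * d + 2 * (d * 0 + d * 1) + 1
  expand = solve-∀
square-add d 1 0 _ = expand d
  where
  expand : ∀ d → (d + 1) * (d + 1) ≡ d * d + 2 * (d * 1 + d * 0) + 1
  expand = solve-∀
square-add d (suc (suc _)) _ (s≤s ())
square-add d (suc a) (suc b) (s≤s le) = ⊥-elim (NP.≤⇒≯ le (subst (0 <_) (sym (NP.+-suc a b)) (s≤s z≤n)))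
square-add d 0 (suc (suc _)) (s≤s ())

record EdgeAdded {n} (A rest : Adj n) (x y : Fin n) : Set where
  field
    x≢y            : x ≢ y
    fresh          : rest x y ≡ false
    split          : ∀ u v → A u v ≡ (rest u v ∨ edge x y u v)
    dg-split       : ∀ u → dg A u ≡ dg rest u + (δ x u + δ y u)
    sqDegSum-split : sqDegSum A ≡ sqDegSum rest + 2 * (dg rest x + dg rest y) + 2

edgeAdded-flip : ∀ {n} {A rest : Adj n} {x y} → Symmetric rest → EdgeAdded A rest x y → EdgeAdded A rest y x
edgeAdded-flip {A = A} {rest} {x} {y} sym-rest added = record
  { x≢y = ≢-sym x≢y
  ; fresh = trans (sym-rest y x) fresh
  ; split = λ u v → trans (split u v) (cong (rest u v ∨_) (edge-flip x y u v))
  ; dg-split = λ u → trans (dg-split u) (cong (dg rest u +_) (NP.+-comm (δ x u) (δ y u)))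
  ; sqDegSum-split = trans sqDegSum-split (cong (λ s → sqDegSum rest + 2 * s + 2) (NP.+-comm (dg rest x) (dg rest y)))
  }
  where open EdgeAdded added

record EdgeRemoval {n} (A : Adj n) : Set where
  field
    x y            : Fin n
    rest           : Adj n
    rest-sym       : Symmetric rest
    rest-irrefl    : Irreflexive rest
    ordEdges-split : ordEdges A ≡ ordEdges rest + 2
    added          : EdgeAdded A rest x y

remove-edge : ∀ {n} (A : Adj n) → Symmetric A → Irreflexive A → 0 < ordEdges A → EdgeRemoval A
remove-edge {n} A sym-A irr-A pos with ∑-pos n (dg A) pos
... | x , dx with ∑-pos n (λ v → ind (A x v)) dx
...   | y , axy = record
  { x = x ; y = y ; rest = rest ; rest-sym = rest-sym ; rest-irrefl = rest-irrefl
  ; ordEdges-split = ordEdges-split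
  ; added = record { x≢y = x≢y ; fresh = fresh ; split = split ; dg-split = dg-split ; sqDegSum-split = sqDegSum-split } }
  where
  Axy : A x y ≡ true
  Axy = ind-true axy
  x≢y : x ≢ y
  x≢y refl = true≢false (trans (sym Axy) (irr-A x))
  rest : Adj n
  rest u v = A u v ∧ not (edge x y u v)
  rest-sym : Symmetric rest
  rest-sym u v = cong₂ (λ a b → a ∧ not b) (sym-A u v) (edge-sym x y u v)
  rest-irrefl : Irreflexive rest
  rest-irrefl u rewrite irr-A u = refl
  fresh : rest x y ≡ false
  fresh rewrite edge-self x y = ∧-zeroʳ (A x y)
  on-edge : ∀ u v → edge x y u v ≡ true → A u v ≡ true
  on-edge u v e with edge-ends {x = x} {y} {u} {v} e
  ... | inj₁ (refl , refl) = Axy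
  ... | inj₂ (refl , refl) = trans (sym-A y x) Axy
  split : ∀ u v → A u v ≡ (rest u v ∨ edge x y u v)
  split u v with edge x y u v in e
  ... | true  rewrite ∧-zeroʳ (A u v) = on-edge u v e
  ... | false rewrite ∧-identityʳ (A u v) = sym (∨-identityʳ (A u v))
  ind-removed : ∀ u v → ind (A u v) ≡ ind (rest u v) + ind (edge x y u v)
  ind-removed u v with edge x y u v in e
  ... | true  rewrite ∧-zeroʳ (A u v) | on-edge u v e = refl
  ... | false rewrite ∧-identityʳ (A u v) = sym (NP.+-identityʳ _)
  dg-split : ∀ u → dg A u ≡ dg rest u + (δ x u + δ y u)
  dg-split u = trans (∑-cong n (ind-removed u))
    (trans (∑-distrib-+ n (λ v → ind (rest u v)) (λ v → ind (edge x y u v))) (cong (dg rest u +_) (dg-edge x≢y u)))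
  δ-sum : ∑ n (λ u → δ x u + δ y u) ≡ 2
  δ-sum = trans (∑-distrib-+ n (δ x) (δ y)) (cong₂ _+_ (∑-δ-one n x) (∑-δ-one n y))
  ordEdges-split : ordEdges A ≡ ordEdges rest + 2
  ordEdges-split = trans (∑-cong n dg-split)
    (trans (∑-distrib-+ n (dg rest) (λ u → δ x u + δ y u)) (cong (ordEdges rest +_) δ-sum))
  square : ∀ u → dg A u * dg A u ≡ dg rest u * dg rest u + 2 * (dg rest u * δ x u + dg rest u * δ y u) + (δ x u + δ y u)
  square u = trans (cong (λ d → d * d) (dg-split u)) (square-add (dg rest u) (δ x u) (δ y u) (δ-pair≤1 x≢y u))
  sqDegSum-split : sqDegSum A ≡ sqDegSum rest + 2 * (dg rest x + dg rest y) + 2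
  sqDegSum-split = begin
    sqDegSum A
      ≡⟨ ∑-cong n square ⟩
    ∑ n (λ u → dg rest u * dg rest u + 2 * (dg rest u * δ x u + dg rest u * δ y u) + (δ x u + δ y u))
      ≡⟨ trans (∑-distrib-+ n _ (λ u → δ x u + δ y u)) (cong₂ _+_ (∑-distrib-+ n (λ u → dg rest u * dg rest u) _) δ-sum) ⟩
    sqDegSum rest + ∑ n (λ u → 2 * (dg rest u * δ x u + dg rest u * δ y u)) + 2
      ≡⟨ cong (λ z → sqDegSum rest + z + 2) (trans (∑-*ˡ n 2 _) (cong (2 *_)
           (trans (∑-distrib-+ n (λ u → dg rest u * δ x u) (λ u → dg rest u * δ y u))
                  (cong₂ _+_ (∑-δʳ n x (dg rest)) (∑-δʳ n y (dg rest)))))) ⟩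
    sqDegSum rest + 2 * (dg rest x + dg rest y) + 2 ∎

no-edges : ∀ {n} (A : Adj n) → ordEdges A ≡ 0 → ∀ u v → A u v ≡ false
no-edges {n} A e u v = ind-false (∑≡0⇒ n (λ w → ind (A u w)) (∑≡0⇒ n (dg A) e u) v)

path₃ : ∀ {n} → Fin n → Fin n → Fin n → Adj n
path₃ c a b u v = edge c a u v ∨ edge c b u v

claw : ∀ {n} → Fin n → Fin n → Fin n → Fin n → Adj n
claw c a b d u v = path₃ c a b u v ∨ edge c d u v

triangleOn : ∀ {n} → Fin n → Fin n → Fin n → Adj n
triangleOn c a b u v = path₃ c a b u v ∨ edge a b u v

record OneEdge {n} (A : Adj n) (x y : Fin n) : Set where
  field
    x≢y            : x ≢ y
    shape          : A ≐ edge x y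
    dg-shape       : ∀ u → dg A u ≡ δ x u + δ y u
    sqDegSum-shape : sqDegSum A ≡ 2

oneEdge-flip : ∀ {n} {A : Adj n} {x y} → OneEdge A x y → OneEdge A y x
oneEdge-flip {x = x} {y} one = record
  { x≢y = ≢-sym x≢y
  ; shape = λ u v → trans (shape u v) (edge-flip x y u v)
  ; dg-shape = λ u → trans (dg-shape u) (NP.+-comm (δ x u) (δ y u))
  ; sqDegSum-shape = sqDegSum-shape }
  where open OneEdge one

one-edge : ∀ {n} (A : Adj n) → Symmetric A → Irreflexive A → ordEdges A ≡ 2 → Σ (Fin n) λ x → Σ (Fin n) λ y → OneEdge A x y
one-edge A sym-A irr-A e = x , y , record
  { x≢y = x≢y
  ; shape = λ u v → trans (split u v) (cong (_∨ edge x y u v) (empty u v))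
  ; dg-shape = λ u → trans (dg-split u) (cong (_+ (δ x u + δ y u)) (dg-empty u))
  ; sqDegSum-shape = trans sqDegSum-split
      (cong₂ (λ s d → s + 2 * d + 2) (∑-zero _ (λ u → cong (λ d → d * d) (dg-empty u))) (cong₂ _+_ (dg-empty x) (dg-empty y))) }
  where
  open EdgeRemoval (remove-edge A sym-A irr-A (subst (0 <_) (sym e) (s≤s z≤n)))
  open EdgeAdded added
  empty : ∀ u v → rest u v ≡ false
  empty = no-edges rest (NP.+-cancelʳ-≡ 2 (ordEdges rest) 0 (trans (sym ordEdges-split) e))
  dg-empty : ∀ u → dg rest u ≡ 0
  dg-empty u = ∑-zero _ (λ v → cong ind (empty u v))

record IsPath₃ {n} (A : Adj n) (c a b : Fin n) : Set where
  field
    c≢a            : c ≢ a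
    c≢b            : c ≢ b
    a≢b            : a ≢ b
    shape          : A ≐ path₃ c a b
    dg-shape       : ∀ u → dg A u ≡ (δ c u + δ a u) + (δ c u + δ b u)
    sqDegSum-shape : sqDegSum A ≡ 6

path₃-from : ∀ {n} {A rest : Adj n} {c a b} → OneEdge rest c a → EdgeAdded A rest c b → IsPath₃ A c a b
path₃-from {A = A} {rest} {c} {a} {b} one added = record
  { c≢a = O.x≢y ; c≢b = E.x≢y ; a≢b = a≢b
  ; shape = λ u v → trans (E.split u v) (cong (_∨ edge c b u v) (O.shape u v))
  ; dg-shape = λ u → trans (E.dg-split u) (cong (_+ (δ c u + δ b u)) (O.dg-shape u))
  ; sqDegSum-shape = trans E.sqDegSum-split (cong₂ (λ s d → s + 2 * d + 2) O.sqDegSum-shape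
      (cong₂ _+_ (trans (O.dg-shape c) (cong₂ _+_ (δ-self c) (δ-≢ O.x≢y)))
                 (trans (O.dg-shape b) (cong₂ _+_ (δ-≢ (≢-sym E.x≢y)) (δ-≢ (≢-sym a≢b)))))) }
  where
  module O = OneEdge one
  module E = EdgeAdded added
  a≢b : a ≢ b
  a≢b refl = true≢false (trans (sym (trans (O.shape c a) (edge-self c a))) E.fresh)

TwoEdges : ∀ {n} → Adj n → Set
TwoEdges {n} A = (Σ (Fin n) λ c → Σ (Fin n) λ a → Σ (Fin n) λ b → IsPath₃ A c a b)
               ⊎ (sqDegSum A ≡ 4 × (∀ u → dg A u ≤ 1))

δ-pair-zero : ∀ {n} {a b u : Fin n} → u ≢ a → u ≢ b → δ a u + δ b u ≡ 0
δ-pair-zero u≢a u≢b = cong₂ _+_ (δ-≢ u≢a) (δ-≢ u≢b)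

two-edges-from : ∀ {n} {A rest : Adj n} {p q x y} → Symmetric rest → OneEdge rest p q → EdgeAdded A rest x y → TwoEdges A
two-edges-from {A = A} {p = p} {q} {x} {y} sym-rest one added with ≡-or-≢ x p | ≡-or-≢ x q | ≡-or-≢ y p | ≡-or-≢ y q
... | inj₁ refl | _ | _ | _ = inj₁ (_ , _ , _ , path₃-from one added)
... | _ | inj₁ refl | _ | _ = inj₁ (_ , _ , _ , path₃-from (oneEdge-flip one) added)
... | _ | _ | inj₁ refl | _ = inj₁ (_ , _ , _ , path₃-from one (edgeAdded-flip sym-rest added))
... | _ | _ | _ | inj₁ refl = inj₁ (_ , _ , _ , path₃-from (oneEdge-flip one) (edgeAdded-flip sym-rest added))
... | inj₂ x≢p | inj₂ x≢q | inj₂ y≢p | inj₂ y≢q = inj₂ (sqDegSum-matching , dg-matching)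
  where
  module O = OneEdge one
  module E = EdgeAdded added
  sqDegSum-matching : sqDegSum A ≡ 4
  sqDegSum-matching = trans E.sqDegSum-split (cong₂ (λ s d → s + 2 * d + 2) O.sqDegSum-shape
    (cong₂ _+_ (trans (O.dg-shape x) (δ-pair-zero x≢p x≢q)) (trans (O.dg-shape y) (δ-pair-zero y≢p y≢q))))
  dg-matching : ∀ u → dg A u ≤ 1
  dg-matching u with ≡-or-≢ u p | ≡-or-≢ u q
  ... | inj₂ u≢p | inj₂ u≢q = NP.≤-trans (NP.≤-reflexive (trans (E.dg-split u)
          (cong (_+ (δ x u + δ y u)) (trans (O.dg-shape u) (δ-pair-zero u≢p u≢q))))) (δ-pair≤1 E.x≢y u)
  ... | inj₁ refl | _ = NP.≤-trans (NP.≤-reflexive (trans (E.dg-split u)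
          (trans (cong₂ _+_ (O.dg-shape u) (δ-pair-zero (≢-sym x≢p) (≢-sym y≢p))) (NP.+-identityʳ _)))) (δ-pair≤1 O.x≢y u)
  ... | _ | inj₁ refl = NP.≤-trans (NP.≤-reflexive (trans (E.dg-split u)
          (trans (cong₂ _+_ (O.dg-shape u) (δ-pair-zero (≢-sym x≢q) (≢-sym y≢q))) (NP.+-identityʳ _)))) (δ-pair≤1 O.x≢y u)

two-edges : ∀ {n} (A : Adj n) → Symmetric A → Irreflexive A → ordEdges A ≡ 4 → TwoEdges A
two-edges {n} A sym-A irr-A e = from-one (one-edge rest rest-sym rest-irrefl (NP.+-cancelʳ-≡ 2 (ordEdges rest) 2 (trans (sym ordEdges-split) e)))
  where
  open EdgeRemoval (remove-edge A sym-A irr-A (subst (0 <_) (sym e) (s≤s z≤n)))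
  from-one : (Σ (Fin n) λ p → Σ (Fin n) λ q → OneEdge rest p q) → TwoEdges A
  from-one (_ , _ , one) = two-edges-from rest-sym one added

record IsClaw {n} (A : Adj n) (c a b d : Fin n) : Set where
  field
    c≢a   : c ≢ a
    c≢b   : c ≢ b
    c≢d   : c ≢ d
    a≢b   : a ≢ b
    a≢d   : a ≢ d
    b≢d   : b ≢ d
    shape : A ≐ claw c a b d

record IsTriangle {n} (A : Adj n) (c a b : Fin n) : Set where
  field
    c≢a   : c ≢ a
    c≢b   : c ≢ b
    a≢b   : a ≢ b
    shape : A ≐ triangleOn c a b

ThreeEdges : ∀ {n} → Adj n → Set
ThreeEdges {n} A = sqDegSum A < 12
  ⊎ (Σ (Fin n) λ c → Σ (Fin n) λ a → Σ (Fin n) λ b → Σ (Fin n) λ d → IsClaw A c a b d)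
  ⊎ (Σ (Fin n) λ c → Σ (Fin n) λ a → Σ (Fin n) λ b → IsTriangle A c a b)

module ThirdEdge {n} {A rest : Adj n} {c a b : Fin n} (path : IsPath₃ rest c a b) where
  private
    module P = IsPath₃ path

  leaf-dg : ∀ {u} → u ≢ c → dg rest u ≡ δ a u + δ b u
  leaf-dg {u} u≢c = trans (P.dg-shape u) (cong₂ (λ p q → (p + δ a u) + (q + δ b u)) (δ-≢ u≢c) (δ-≢ u≢c))

  fresh-leaf : ∀ {d} → rest c d ≡ false → d ≢ a × d ≢ b
  fresh-leaf fresh = (λ { refl → true≢false (trans (sym (at-centre (inj₁ refl))) fresh) })
                   , (λ { refl → true≢false (trans (sym (at-centre (inj₂ refl))) fresh) })
    where
    at-centre : ∀ {d} → d ≡ a ⊎ d ≡ b → rest c d ≡ true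
    at-centre (inj₁ refl) = trans (P.shape c a) (cong (_∨ edge c b c a) (edge-self c a))
    at-centre (inj₂ refl) = trans (P.shape c b) (trans (cong (edge c a c b ∨_) (edge-self c b)) (∨-zeroʳ _))

  claw-from : ∀ {d} → EdgeAdded A rest c d → IsClaw A c a b d
  claw-from {d} added = record
    { c≢a = P.c≢a ; c≢b = P.c≢b ; c≢d = E.x≢y ; a≢b = P.a≢b
    ; a≢d = ≢-sym (proj₁ (fresh-leaf E.fresh)) ; b≢d = ≢-sym (proj₂ (fresh-leaf E.fresh))
    ; shape = λ u v → trans (E.split u v) (cong (_∨ edge c d u v) (P.shape u v)) }
    where module E = EdgeAdded added

  triangle-from : EdgeAdded A rest a b → IsTriangle A c a b
  triangle-from added = record
    { c≢a = P.c≢a ; c≢b = P.c≢b ; a≢b = P.a≢b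
    ; shape = λ u v → trans (E.split u v) (cong (_∨ edge a b u v) (P.shape u v)) }
    where module E = EdgeAdded added

  small-from : ∀ {x y} → EdgeAdded A rest x y → dg rest x + dg rest y ≤ 1 → sqDegSum A < 12
  small-from added s≤1 = subst (_< 12) (sym (trans E.sqDegSum-split (cong (λ s → s + 2 * (dg rest _ + dg rest _) + 2) P.sqDegSum-shape)))
                                (below-12 s≤1)
    where
    module E = EdgeAdded added
    below-12 : ∀ {s} → s ≤ 1 → 6 + 2 * s + 2 < 12
    below-12 z≤n       = NP.<ᵇ⇒< 8 12 tt
    below-12 (s≤s z≤n) = NP.<ᵇ⇒< 10 12 tt

  triangle-swapped : EdgeAdded A rest b a → IsTriangle A c b a
  triangle-swapped added = record
    { c≢a = P.c≢b ; c≢b = P.c≢a ; a≢b = ≢-sym P.a≢b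
    ; shape = λ u v → trans (EdgeAdded.split added u v)
                (cong (_∨ edge b a u v) (trans (P.shape u v) (∨-comm (edge c a u v) (edge c b u v)))) }

  -- Away from the centre the new edge touches at most one leaf, unless it joins the two leaves.
  off-centre : ∀ {x y} → x ≢ c → y ≢ c → EdgeAdded A rest x y → ThreeEdges A
  off-centre {x} {y} x≢c y≢c added with ≡-or-≢ x a | ≡-or-≢ x b
  ... | inj₁ x≡a | _ = from-a (≡-or-≢ y b)
    where
    from-a : y ≡ b ⊎ y ≢ b → ThreeEdges A
    from-a (inj₁ y≡b) = inj₂ (inj₂ (c , a , b , triangle-from (subst₂ (EdgeAdded A rest) x≡a y≡b added)))
    from-a (inj₂ y≢b) = inj₁ (small-from added (NP.≤-reflexive (cong₂ _+_
      (trans (leaf-dg x≢c) (cong₂ _+_ (trans (cong (δ a) x≡a) (δ-self a)) (δ-≢ (λ x≡b → P.a≢b (trans (sym x≡a) x≡b)))))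
      (trans (leaf-dg y≢c) (δ-pair-zero (λ y≡a → EdgeAdded.x≢y added (trans x≡a (sym y≡a))) y≢b)))))
  ... | inj₂ x≢a | inj₁ x≡b = from-b (≡-or-≢ y a)
    where
    from-b : y ≡ a ⊎ y ≢ a → ThreeEdges A
    from-b (inj₁ y≡a) = inj₂ (inj₂ (c , b , a , triangle-swapped (subst₂ (EdgeAdded A rest) x≡b y≡a added)))
    from-b (inj₂ y≢a) = inj₁ (small-from added (NP.≤-reflexive (cong₂ _+_
      (trans (leaf-dg x≢c) (cong₂ _+_ (δ-≢ x≢a) (trans (cong (δ b) x≡b) (δ-self b))))
      (trans (leaf-dg y≢c) (δ-pair-zero y≢a (λ y≡b → EdgeAdded.x≢y added (trans x≡b (sym y≡b))))))))
  ... | inj₂ x≢a | inj₂ x≢b = inj₁ (small-from added (NP.≤-trans (NP.≤-reflexive (cong₂ _+_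
      (trans (leaf-dg x≢c) (δ-pair-zero x≢a x≢b)) (leaf-dg y≢c))) (δ-pair≤1 P.a≢b y)))

three-edges-from : ∀ {n} {A rest : Adj n} {c a b x y} → Symmetric rest → IsPath₃ rest c a b → EdgeAdded A rest x y →
  ThreeEdges A
three-edges-from {c = c} {a} {b} {x} {y} sym-rest path added with ≡-or-≢ x c | ≡-or-≢ y c
... | inj₁ refl | _ = inj₂ (inj₁ (_ , _ , _ , _ , ThirdEdge.claw-from path added))
... | _ | inj₁ refl = inj₂ (inj₁ (_ , _ , _ , _ , ThirdEdge.claw-from path (edgeAdded-flip sym-rest added)))
... | inj₂ x≢c | inj₂ y≢c = ThirdEdge.off-centre path x≢c y≢c added

three-edges : ∀ {n} (A : Adj n) → Symmetric A → Irreflexive A → ordEdges A ≡ 6 → ThreeEdges A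
three-edges {n} A sym-A irr-A e = from-two (two-edges rest rest-sym rest-irrefl (NP.+-cancelʳ-≡ 2 (ordEdges rest) 4 (trans (sym ordEdges-split) e)))
  where
  open EdgeRemoval (remove-edge A sym-A irr-A (subst (0 <_) (sym e) (s≤s z≤n)))
  from-two : TwoEdges rest → ThreeEdges A
  from-two (inj₁ (_ , _ , _ , path)) = three-edges-from rest-sym path added
  from-two (inj₂ (sqDegSum-rest , dg≤1)) = inj₁ (subst (_< 12)
    (sym (trans (EdgeAdded.sqDegSum-split added) (cong (λ s → s + 2 * (dg rest x + dg rest y) + 2) sqDegSum-rest)))
    (below-12 (dg≤1 x) (dg≤1 y)))
    where
    below-12 : ∀ {d e} → d ≤ 1 → e ≤ 1 → 4 + 2 * (d + e) + 2 < 12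
    below-12 z≤n       z≤n       = NP.<ᵇ⇒< 6 12 tt
    below-12 z≤n       (s≤s z≤n) = NP.<ᵇ⇒< 8 12 tt
    below-12 (s≤s z≤n) z≤n       = NP.<ᵇ⇒< 8 12 tt
    below-12 (s≤s z≤n) (s≤s z≤n) = NP.<ᵇ⇒< 10 12 tt

-- Canonical graphs on the first four vertices

isCentre : ∀ {n} → Fin n → Bool
isCentre u = toℕ u ≡ᵇ 0

isLeaf : ∀ {n} → ℕ → Fin n → Bool
isLeaf t v = (0 <ᵇ toℕ v) ∧ (toℕ v ≤ᵇ t)

-- K_{1,t} with centre 0 and leaves 1, …, t, plus isolated vertices.
star : ∀ {n} → ℕ → Adj n
star t u v = if u == v then false else ((isCentre u ∧ isLeaf t v) ∨ (isCentre v ∧ isLeaf t u))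

triangle : ∀ {n} → Adj n
triangle u v = (toℕ u <ᵇ 3) ∧ (toℕ v <ᵇ 3) ∧ not (u == v)

star-sym : ∀ {n} t → Symmetric (star {n} t)
star-sym t u v rewrite ==-sym u v =
  cong (if v == u then false else_) (∨-comm (isCentre u ∧ isLeaf t v) (isCentre v ∧ isLeaf t u))

triangle-sym : ∀ {n} → Symmetric (triangle {n})
triangle-sym u v rewrite ==-sym u v = swap (toℕ u <ᵇ 3) (toℕ v <ᵇ 3) (not (v == u))
  where
  swap : ∀ a b c → (a ∧ b ∧ c) ≡ (b ∧ a ∧ c)
  swap true  b     c = refl
  swap false true  c = refl
  swap false false c = refl

module Isolated {s R : ℕ} (A : Adj (s + R)) (sym-A : Symmetric A) (far-A : ∀ i v → A (s ↑ʳ i) v ≡ false) where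
  restrict : Adj s
  restrict p q = A (p ↑ˡ R) (q ↑ˡ R)

  private
    far-A′ : ∀ u i → A u (s ↑ʳ i) ≡ false
    far-A′ u i = trans (sym-A u (s ↑ʳ i)) (far-A i u)

  dg-near : ∀ p → dg A (p ↑ˡ R) ≡ dg restrict p
  dg-near p = ∑-restrict s R _ (λ i → cong ind (far-A′ (p ↑ˡ R) i))

  dg-far : ∀ i → dg A (s ↑ʳ i) ≡ 0
  dg-far i = ∑-zero (s + R) (λ v → cong ind (far-A i v))

  ordEdges-restrict : ordEdges A ≡ ordEdges restrict
  ordEdges-restrict = trans (∑-restrict s R (dg A) dg-far) (∑-cong s dg-near)

  sqDegSum-restrict : sqDegSum A ≡ sqDegSum restrict
  sqDegSum-restrict = trans (∑-restrict s R _ (λ i → cong (λ d → d * d) (dg-far i)))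
                            (∑-cong s (λ p → cong₂ _*_ (dg-near p) (dg-near p)))

  ordM₂-restrict : ordM₂ A ≡ ordM₂ restrict
  ordM₂-restrict =
    trans (∑-restrict s R _ (λ i → ∑-zero (s + R) (λ v → cong (λ b → ind b * (dg A (s ↑ʳ i) * dg A v)) (far-A i v))))
          (∑-cong s (λ p → trans (∑-restrict s R _ (λ i →
                                    cong (λ b → ind b * (dg A (p ↑ˡ R) * dg A (s ↑ʳ i))) (far-A′ (p ↑ˡ R) i)))
                                 (∑-cong s (λ q → cong (ind (restrict p q) *_) (cong₂ _*_ (dg-near p) (dg-near q))))))

  ordK₃-restrict : ordK₃ A ≡ ordK₃ restrict
  ordK₃-restrict =
    trans (∑-restrict s R _ (λ i → ∑-zero (s + R) (λ j → ∑-zero (s + R) (λ k →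
                cong ind (∧₃-false (A (s ↑ʳ i) j) (A j k) (A (s ↑ʳ i) k) (inj₁ (far-A i j)))))))
          (∑-cong s (λ p → trans (∑-restrict s R _ (λ i → ∑-zero (s + R) (λ k →
                cong ind (∧₃-false (A (p ↑ˡ R) (s ↑ʳ i)) (A (s ↑ʳ i) k) (A (p ↑ˡ R) k) (inj₁ (far-A′ (p ↑ˡ R) i))))))
          (∑-cong s (λ q → ∑-restrict s R _ (λ i → cong ind
                (∧₃-false (A (p ↑ˡ R) (q ↑ˡ R)) (A (q ↑ˡ R) (s ↑ʳ i)) (A (p ↑ˡ R) (s ↑ʳ i)) (inj₂ (inj₁ (far-A′ (q ↑ˡ R) i)))))))))

data Position (s R : ℕ) : Fin (s + R) → Set where
  near : (p : Fin s) → Position s R (p ↑ˡ R)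
  far  : (i : Fin R) → Position s R (s ↑ʳ i)

position : ∀ s {R} (u : Fin (s + R)) → Position s R u
position zero    u         = far u
position (suc s) F.zero    = near F.zero
position (suc s) (F.suc u) with position s u
... | near p = near (F.suc p)
... | far i  = far i

-- The agreement on the first s vertices is decided by evaluation, so callers pass _ for it.
≐-from-prefix : ∀ {s R} (A B : Adj (s + R)) → Symmetric A → Symmetric B →
  (∀ i v → A (s ↑ʳ i) v ≡ false) → (∀ i v → B (s ↑ʳ i) v ≡ false) →
  True (FP.all? λ p → FP.all? λ q → A (p ↑ˡ R) (q ↑ˡ R) ≟ᵇ B (p ↑ˡ R) (q ↑ˡ R)) → A ≐ B
≐-from-prefix {s} {R} A B sym-A sym-B far-A far-B check u v = go (position s u) (position s v)
  where
  go : ∀ {u v} → Position s R u → Position s R v → A u v ≡ B u v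
  go (near p) (near q) = toWitness check p q
  go (far i)  _        = trans (far-A i _) (sym (far-B i _))
  go (near p) (far i)  = trans (sym-A _ _) (trans (far-A i _) (trans (sym (far-B i _)) (sym-B _ _)))

path₃-sym : ∀ {n} (c a b : Fin n) → Symmetric (path₃ c a b)
path₃-sym c a b u v = cong₂ _∨_ (edge-sym c a u v) (edge-sym c b u v)

claw-sym : ∀ {n} (c a b d : Fin n) → Symmetric (claw c a b d)
claw-sym c a b d u v = cong₂ _∨_ (path₃-sym c a b u v) (edge-sym c d u v)

triangleOn-sym : ∀ {n} (c a b : Fin n) → Symmetric (triangleOn c a b)
triangleOn-sym c a b u v = cong₂ _∨_ (path₃-sym c a b u v) (edge-sym a b u v)

module _ {n} (σ : Permutation′ n) where
  private
    s : Fin n → Fin n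
    s u = σ ⟨$⟩ʳ u

  ==-relabel : ∀ u v → (s u == s v) ≡ (u == v)
  ==-relabel u v with ≡-or-≢ u v
  ... | inj₁ refl = trans (==-refl (s u)) (sym (==-refl u))
  ... | inj₂ ne = trans (==-≢ (λ e → ne (permutation-injective σ e))) (sym (==-≢ ne))

  edge-relabel : ∀ {x y x′ y′} → s x ≡ x′ → s y ≡ y′ → ∀ u v → edge x y u v ≡ edge x′ y′ (s u) (s v)
  edge-relabel {x} {y} refl refl u v rewrite ==-relabel u x | ==-relabel v y | ==-relabel u y | ==-relabel v x = refl

  path₃-relabel : ∀ {c a b c′ a′ b′} → s c ≡ c′ → s a ≡ a′ → s b ≡ b′ → ∀ u v →
    path₃ c a b u v ≡ path₃ c′ a′ b′ (s u) (s v)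
  path₃-relabel ec ea eb u v = cong₂ _∨_ (edge-relabel ec ea u v) (edge-relabel ec eb u v)

  claw-relabel : ∀ {c a b d c′ a′ b′ d′} → s c ≡ c′ → s a ≡ a′ → s b ≡ b′ → s d ≡ d′ → ∀ u v →
    claw c a b d u v ≡ claw c′ a′ b′ d′ (s u) (s v)
  claw-relabel ec ea eb ed u v = cong₂ _∨_ (path₃-relabel ec ea eb u v) (edge-relabel ec ed u v)

  triangleOn-relabel : ∀ {c a b c′ a′ b′} → s c ≡ c′ → s a ≡ a′ → s b ≡ b′ → ∀ u v →
    triangleOn c a b u v ≡ triangleOn c′ a′ b′ (s u) (s v)
  triangleOn-relabel ec ea eb u v = cong₂ _∨_ (path₃-relabel ec ea eb u v) (edge-relabel ea eb u v)

send₂ : ∀ {n} {x y x′ y′ : Fin n} → x ≢ y → x′ ≢ y′ →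
  Σ (Permutation′ n) λ σ → σ ⟨$⟩ʳ x ≡ x′ × σ ⟨$⟩ʳ y ≡ y′
send₂ {x = x} {y} {x′} {y′} d d′ with extend ((x , x′) ∷ (y , y′) ∷ []) (((d , d′) ∷ []) , [] , tt)
... | σ , (e₁ ∷ e₂ ∷ []) = σ , e₁ , e₂

send₃ : ∀ {n} {x y z x′ y′ z′ : Fin n} → x ≢ y → x ≢ z → y ≢ z → x′ ≢ y′ → x′ ≢ z′ → y′ ≢ z′ →
  Σ (Permutation′ n) λ σ → σ ⟨$⟩ʳ x ≡ x′ × σ ⟨$⟩ʳ y ≡ y′ × σ ⟨$⟩ʳ z ≡ z′
send₃ {x = x} {y} {z} {x′} {y′} {z′} a b c a′ b′ c′
  with extend ((x , x′) ∷ (y , y′) ∷ (z , z′) ∷ []) (((a , a′) ∷ (b , b′) ∷ []) , ((c , c′) ∷ []) , [] , tt)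
... | σ , (e₁ ∷ e₂ ∷ e₃ ∷ []) = σ , e₁ , e₂ , e₃

send₄ : ∀ {n} {x y z w x′ y′ z′ w′ : Fin n} →
  x ≢ y → x ≢ z → x ≢ w → y ≢ z → y ≢ w → z ≢ w →
  x′ ≢ y′ → x′ ≢ z′ → x′ ≢ w′ → y′ ≢ z′ → y′ ≢ w′ → z′ ≢ w′ →
  Σ (Permutation′ n) λ σ → σ ⟨$⟩ʳ x ≡ x′ × σ ⟨$⟩ʳ y ≡ y′ × σ ⟨$⟩ʳ z ≡ z′ × σ ⟨$⟩ʳ w ≡ w′
send₄ {x = x} {y} {z} {w} {x′} {y′} {z′} {w′} a b c d e f a′ b′ c′ d′ e′ f′
  with extend ((x , x′) ∷ (y , y′) ∷ (z , z′) ∷ (w , w′) ∷ [])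
              (((a , a′) ∷ (b , b′) ∷ (c , c′) ∷ []) , ((d , d′) ∷ (e , e′) ∷ []) , ((f , f′) ∷ []) , [] , tt)
... | σ , (e₁ ∷ e₂ ∷ e₃ ∷ e₄ ∷ []) = σ , e₁ , e₂ , e₃ , e₄

module Canonical {R : ℕ} where
  private
    n = 4 + R

  f0 f1 f2 f3 : Fin n
  f0 = F.zero
  f1 = F.suc F.zero
  f2 = F.suc (F.suc F.zero)
  f3 = F.suc (F.suc (F.suc F.zero))

  isLeaf-far : ∀ t → t ≤ 3 → ∀ (i : Fin R) → isLeaf t (4 ↑ʳ i) ≡ false
  isLeaf-far t t≤3 i = Bool-ext (λ l → ⊥-elim (too-big (NP.≤-trans (NP.≤ᵇ⇒≤ (4 + toℕ i) t (proj₂′ l)) t≤3))) λ ()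
    where
    proj₂′ : ∀ {a b} → T (a ∧ b) → T b
    proj₂′ {true} t = t
    too-big : ∀ {x} → ¬ 4 + x ≤ 3
    too-big (s≤s (s≤s (s≤s ())))

  star-far : ∀ t → t ≤ 3 → ∀ (i : Fin R) v → star t (4 ↑ʳ i) v ≡ false
  star-far t t≤3 i v rewrite isLeaf-far t t≤3 i | ∧-zeroʳ (isCentre v) with (4 ↑ʳ i) == v
  ... | true  = refl
  ... | false = refl

  f0≢f1 : f0 ≢ f1
  f0≢f1 ()
  f0≢f2 : f0 ≢ f2
  f0≢f2 ()
  f0≢f3 : f0 ≢ f3
  f0≢f3 ()
  f1≢f2 : f1 ≢ f2
  f1≢f2 ()
  f1≢f3 : f1 ≢ f3
  f1≢f3 ()
  f2≢f3 : f2 ≢ f3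
  f2≢f3 ()

  private
    module IsolatedStar (t : ℕ) (t≤3 : t ≤ 3) = Isolated {4} {R} (star {n} t) (star-sym t) (star-far t t≤3)
    module IsolatedTriangle = Isolated {4} {R} (triangle {n}) triangle-sym (λ i v → refl)

  star-ordEdges : ∀ t → t ≤ 3 → ordEdges (star {n} t) ≡ 2 * t
  star-ordEdges t t≤3 = trans (IsolatedStar.ordEdges-restrict t t≤3) (on-Fin4 t t≤3)
    where
    on-Fin4 : ∀ t (t≤3 : t ≤ 3) → ordEdges (IsolatedStar.restrict t t≤3) ≡ 2 * t
    on-Fin4 0 _ = refl
    on-Fin4 1 _ = refl
    on-Fin4 2 _ = refl
    on-Fin4 3 _ = refl
    on-Fin4 (suc (suc (suc (suc _)))) (s≤s (s≤s (s≤s ())))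

  star₂-sqDegSum : sqDegSum (star {n} 2) ≡ 6
  star₂-sqDegSum = IsolatedStar.sqDegSum-restrict 2 (s≤s (s≤s z≤n))

  star₃-sqDegSum : sqDegSum (star {n} 3) ≡ 12
  star₃-sqDegSum = IsolatedStar.sqDegSum-restrict 3 (s≤s (s≤s (s≤s z≤n)))

  triangle-ordEdges : ordEdges (triangle {n}) ≡ 6
  triangle-ordEdges = IsolatedTriangle.ordEdges-restrict

  triangle-sqDegSum : sqDegSum (triangle {n}) ≡ 12
  triangle-sqDegSum = IsolatedTriangle.sqDegSum-restrict

  -- 2 H(K₃) = 24 - 2·6 < 18 - 2·0 = 2 H(K_{1,3}).
  triangle-below-star₃ : ordM₂ (triangle {n}) + 2 * ordK₃ (star {n} 3) < ordM₂ (star {n} 3) + 2 * ordK₃ (triangle {n})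
  triangle-below-star₃ = subst₂ _<_
    (sym (cong₂ (λ x y → x + 2 * y) IsolatedTriangle.ordM₂-restrict (IsolatedStar.ordK₃-restrict 3 (s≤s (s≤s (s≤s z≤n))))))
    (sym (cong₂ (λ x y → x + 2 * y) (IsolatedStar.ordM₂-restrict 3 (s≤s (s≤s (s≤s z≤n)))) IsolatedTriangle.ordK₃-restrict))
    (NP.<ᵇ⇒< 24 30 tt)

  edge≃star : ∀ {p q : Fin n} → p ≢ q → edge p q ≃ star 1
  edge≃star {p} {q} p≢q with send₂ p≢q f0≢f1
  ... | σ , e₁ , e₂ = ≃-≐ (relabelling σ (edge-relabel σ e₁ e₂))
    (≐-from-prefix {4} {R} (edge f0 f1) (star 1) (edge-sym f0 f1) (star-sym 1) (λ i v → refl) (star-far 1 (s≤s z≤n)) _)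

  path₃≃star : ∀ {c a b : Fin n} → c ≢ a → c ≢ b → a ≢ b → path₃ c a b ≃ star 2
  path₃≃star {c} {a} {b} c≢a c≢b a≢b with send₃ c≢a c≢b a≢b f0≢f1 f0≢f2 f1≢f2
  ... | σ , e₁ , e₂ , e₃ = ≃-≐ (relabelling σ (path₃-relabel σ e₁ e₂ e₃))
    (≐-from-prefix {4} {R} (path₃ f0 f1 f2) (star 2) (path₃-sym f0 f1 f2) (star-sym 2) (λ i v → refl) (star-far 2 (s≤s (s≤s z≤n))) _)

  claw≃star : ∀ {c a b d : Fin n} → c ≢ a → c ≢ b → c ≢ d → a ≢ b → a ≢ d → b ≢ d → claw c a b d ≃ star 3
  claw≃star {c} {a} {b} {d} c≢a c≢b c≢d a≢b a≢d b≢d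
    with send₄ c≢a c≢b c≢d a≢b a≢d b≢d f0≢f1 f0≢f2 f0≢f3 f1≢f2 f1≢f3 f2≢f3
  ... | σ , e₁ , e₂ , e₃ , e₄ = ≃-≐ (relabelling σ (claw-relabel σ e₁ e₂ e₃ e₄))
    (≐-from-prefix {4} {R} (claw f0 f1 f2 f3) (star 3) (claw-sym f0 f1 f2 f3) (star-sym 3) (λ i v → refl)
                   (star-far 3 (s≤s (s≤s (s≤s z≤n)))) _)

  triangleOn≃triangle : ∀ {c a b : Fin n} → c ≢ a → c ≢ b → a ≢ b → triangleOn c a b ≃ triangle
  triangleOn≃triangle {c} {a} {b} c≢a c≢b a≢b with send₃ c≢a c≢b a≢b f0≢f1 f0≢f2 f1≢f2
  ... | σ , e₁ , e₂ , e₃ = ≃-≐ (relabelling σ (triangleOn-relabel σ e₁ e₂ e₃))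
    (≐-from-prefix {4} {R} (triangleOn f0 f1 f2) triangle (triangleOn-sym f0 f1 f2) triangle-sym (λ i v → refl) (λ i v → refl) _)

-- Normal forms of the quasi-star

module _ {p q a b : ℕ} (c m : ℕ) (hp : p + c ≡ m + a) (hq : q + c ≡ m + b) where
  ≤-transfer : p ≤ q → a ≤ b
  ≤-transfer p≤q = NP.+-cancelˡ-≤ m a b (subst₂ _≤_ hp hq (NP.+-monoˡ-≤ c p≤q))

  ≤-transfer⁻ : a ≤ b → p ≤ q
  ≤-transfer⁻ a≤b = NP.+-cancelʳ-≤ c p q (subst₂ _≤_ (sym hp) (sym hq) (NP.+-monoʳ-≤ m a≤b))

  ≤ᵇ-transfer : (p ≤ᵇ q) ≡ (a ≤ᵇ b)
  ≤ᵇ-transfer = Bool-ext (λ t → NP.≤⇒≤ᵇ (≤-transfer (NP.≤ᵇ⇒≤ p q t)))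
                         (λ t → NP.≤⇒≤ᵇ (≤-transfer⁻ (NP.≤ᵇ⇒≤ a b t)))

  ≡ᵇ-transfer : (p ≡ᵇ q) ≡ (a ≡ᵇ b)
  ≡ᵇ-transfer = Bool-ext
    (λ t → NP.≡⇒≡ᵇ a b (NP.+-cancelˡ-≡ m a b (trans (sym hp) (trans (cong (_+ c) (NP.≡ᵇ⇒≡ p q t)) hq))))
    (λ t → NP.≡⇒≡ᵇ p q (NP.+-cancelʳ-≡ c p q (trans hp (trans (cong (m +_) (NP.≡ᵇ⇒≡ a b t)) (sym hq)))))

<ᵇ-transfer : ∀ {p q a b : ℕ} (c m : ℕ) → p + c ≡ m + a → q + c ≡ m + b → (p <ᵇ q) ≡ (a <ᵇ b)
<ᵇ-transfer {p} {q} {a} {b} c m hp hq = Bool-ext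
  (λ t → NP.<⇒<ᵇ (≤-transfer c m hp′ hq (NP.<ᵇ⇒< p q t)))
  (λ t → NP.<⇒<ᵇ (≤-transfer⁻ c m hp′ hq (NP.<ᵇ⇒< a b t)))
  where
  hp′ : suc p + c ≡ m + suc a
  hp′ = trans (cong suc hp) (sym (NP.+-suc m a))

if-false : ∀ b → (if b then false else false) ≡ false
if-false true  = refl
if-false false = refl

isLeaf-zero : ∀ {n} (v : Fin n) → isLeaf 0 v ≡ false
isLeaf-zero v with toℕ v
... | zero  = refl
... | suc _ = refl

star-zero : ∀ {n} (u v : Fin n) → star 0 u v ≡ false
star-zero u v rewrite isLeaf-zero u | isLeaf-zero v | ∧-zeroʳ (isCentre u) | ∧-zeroʳ (isCentre v) = if-false (u == v)

module _ (k j : ℕ) where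
  open QuasiStar (suc k) k j

  private
    front-core : ∀ (u : Fin (suc k)) → core u ≡ false
    front-core u = ≤ᵇ-transfer 0 (suc k) (shift (toℕ u) k) refl
      where
      shift : ∀ x k → suc (suc x + k) + 0 ≡ suc k + suc x
      shift = solve-∀

    front-centre : ∀ (u : Fin (suc k)) → centre u ≡ isCentre u
    front-centre u = ≡ᵇ-transfer 0 (suc k) (shift (toℕ u) k) refl
      where
      shift : ∀ x k → suc x + k + 0 ≡ suc k + x
      shift = solve-∀

    front-leaf : ∀ (v : Fin (suc k)) → leaf v ≡ isLeaf j v
    front-leaf v = cong₂ _∧_ (<ᵇ-transfer 0 (suc k) refl (shift (toℕ v) k))
                             (≤ᵇ-transfer 0 (suc k) (shift (toℕ v) k) (NP.+-identityʳ (suc k + j)))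
      where
      shift : ∀ x k → suc x + k + 0 ≡ suc k + x
      shift = solve-∀

    front-rel : ∀ (u v : Fin (suc k)) → rel u v ≡ (isCentre u ∧ isLeaf j v)
    front-rel u v = cong₂ _∨_ (front-core u) (cong₂ _∧_ (front-centre u) (front-leaf v))

  quasiStar-front : adj (quasiStar (suc k) k j) ≐ star j
  quasiStar-front u v = cong₂ (λ r s → if u == v then false else (r ∨ s)) (front-rel u v) (front-rel v u)

module _ (n : ℕ) where
  open QuasiStar n n n

  private
    empty-rel : ∀ (u v : Fin n) → rel u v ≡ false
    empty-rel u v = cong₂ (λ c z → c ∨ (z ∧ leaf v))
      (≤ᵇ-transfer 0 n (shift₂ (toℕ u) n) refl)
      (≡ᵇ-transfer 0 n (shift₁ (toℕ u) n) refl)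
      where
      shift₁ : ∀ x n → suc x + n + 0 ≡ n + suc x
      shift₁ = solve-∀
      shift₂ : ∀ x n → suc (suc x + n) + 0 ≡ n + suc (suc x)
      shift₂ = solve-∀

  quasiStar-empty : adj (quasiStar n n n) ≐ star 0
  quasiStar-empty u v =
    trans (cong₂ (λ r s → if u == v then false else (r ∨ s)) (empty-rel u v) (empty-rel v u))
          (trans (if-false (u == v)) (sym (star-zero u v)))

relᵒᵖ : ∀ {n} → ℕ → ℕ → Fin n → Fin n → Bool
relᵒᵖ k j u v = (suc k ≤ᵇ toℕ u) ∨ ((k ≡ᵇ toℕ u) ∧ ((toℕ v <ᵇ k) ∧ (k ≤ᵇ toℕ v + j)))

-- The quasi-star read from the back: vertex u of quasiStarᵒᵖ is vertex n ∸ 1 ∸ u of the quasi-star.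
quasiStarᵒᵖ : ∀ {n} → ℕ → ℕ → Adj n
quasiStarᵒᵖ k j u v = if u == v then false else (relᵒᵖ k j u v ∨ relᵒᵖ k j v u)

quasiStarᵒᵖ-sym : ∀ {n} k j → Symmetric (quasiStarᵒᵖ {n} k j)
quasiStarᵒᵖ-sym k j u v rewrite ==-sym u v = cong (if v == u then false else_) (∨-comm (relᵒᵖ k j u v) (relᵒᵖ k j v u))

opposite : ∀ {n} → Permutation′ n
opposite = Perm.permutation F.opposite F.opposite FP.opposite-involutive FP.opposite-involutive

module _ (n k j : ℕ) where
  open QuasiStar n k j

  private
    position-opposite : ∀ (u : Fin n) → pos+k (F.opposite u) + toℕ u ≡ n + k
    position-opposite u rewrite FP.opposite-prop u = trans (shift (n ∸ suc (toℕ u)) (toℕ u) k)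
                                                         (cong (_+ k) (NP.m∸n+n≡m (FP.toℕ<n u)))
      where
      shift : ∀ d x k → suc d + k + x ≡ d + suc x + k
      shift = solve-∀

    opposite-rel : ∀ (u v : Fin n) → rel (F.opposite u) (F.opposite v) ≡ relᵒᵖ k j u v
    opposite-rel u v = cong₂ (λ c z → c ∨ z)
      (≤ᵇ-transfer (toℕ u) n (trans (cong suc (position-opposite u)) (sym (NP.+-suc n k))) refl)
      (cong₂ _∧_ (≡ᵇ-transfer (toℕ u) n (position-opposite u) refl)
                 (cong₂ _∧_ (<ᵇ-transfer (toℕ v) n refl (position-opposite v))
                            (≤ᵇ-transfer (toℕ v) n (position-opposite v) (shift n j (toℕ v)))))
      where
      shift : ∀ n j y → n + j + y ≡ n + (y + j)
      shift = solve-∀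

    opposite-== : ∀ (u v : Fin n) → (F.opposite u == F.opposite v) ≡ (u == v)
    opposite-== u v = ==-relabel (opposite {n}) u v

  quasiStar-opposite : quasiStarᵒᵖ k j ≃ adj (quasiStar n k j)
  quasiStar-opposite = relabelling (opposite {n}) λ u v → sym
    (cong₂ (λ e r → if e then false else r) (opposite-== u v) (cong₂ _∨_ (opposite-rel u v) (opposite-rel v u)))

2*C₂+n : ∀ n → 2 * (n C 2) + n ≡ n * n
2*C₂+n zero    = refl
2*C₂+n (suc n) = begin
  2 * (suc n C 2) + suc n          ≡⟨ cong (λ z → 2 * z + suc n) (sym (nCk+nC[k+1]≡[n+1]C[k+1] n 1)) ⟩
  2 * (n C 1 + n C 2) + suc n      ≡⟨ cong (λ z → 2 * (z + n C 2) + suc n) (nC1≡n n) ⟩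
  2 * (n + n C 2) + suc n          ≡⟨ regroup n (n C 2) ⟩
  2 * (n C 2) + n + (2 * n + 1)    ≡⟨ cong (_+ (2 * n + 1)) (2*C₂+n n) ⟩
  n * n + (2 * n + 1)              ≡⟨ square n ⟩
  suc n * suc n                    ∎
  where
  regroup : ∀ n c → 2 * (n + c) + suc n ≡ 2 * c + n + (2 * n + 1)
  regroup = solve-∀
  square : ∀ n → n * n + (2 * n + 1) ≡ suc n * suc n
  square = solve-∀

C₂-suc : ∀ k → suc k C 2 ≡ k + k C 2
C₂-suc k = trans (sym (nCk+nC[k+1]≡[n+1]C[k+1] k 1)) (cong (_+ k C 2) (nC1≡n k))

C₂-mono : ∀ {a b} → a ≤ b → a C 2 ≤ b C 2
C₂-mono {a} a≤b with NP.m≤n⇒∃[o]m+o≡n a≤b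
... | o , refl = go o
  where
  go : ∀ o → a C 2 ≤ (a + o) C 2
  go zero    = NP.≤-reflexive (cong (_C 2) (sym (NP.+-identityʳ a)))
  go (suc o) = NP.≤-trans (go o) (NP.≤-trans (NP.m≤n+m _ (a + o))
                 (NP.≤-reflexive (trans (sym (C₂-suc (a + o))) (cong (_C 2) (sym (NP.+-suc a o))))))

C₂-< : ∀ {a b} → a < b → a C 2 + a ≤ b C 2
C₂-< {a} a<b = NP.≤-trans (NP.≤-reflexive (trans (NP.+-comm (a C 2) a) (sym (C₂-suc a)))) (C₂-mono a<b)

module _ {N : ℕ} (G : Graph (suc N)) where
  private
    n = suc N
    open Complement (adj G) (adj-sym G) (irrefl G)

  edges+compl : 2 * edges G + ordEdges (compl (adj G)) ≡ 2 * (n C 2)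
  edges+compl = NP.+-cancelʳ-≡ n _ _ (begin
    2 * edges G + ordEdges (compl (adj G)) + n ≡⟨ cong (λ e → e + ordEdges (compl (adj G)) + n) (sym (Conversion.ordEdges≡2*edges G)) ⟩
    ordEdges (adj G) + ordEdges (compl (adj G)) + n ≡⟨ ordEdges-compl ⟩
    n * n ≡⟨ sym (2*C₂+n n) ⟩
    2 * (n C 2) + n ∎)

  ∈-compl : ∀ {t} → t ≤ n C 2 → InG n (n C 2 ∸ t) G → ordEdges (compl (adj G)) ≡ 2 * t
  ∈-compl {t} t≤C G∈ = NP.+-cancelˡ-≡ (2 * (n C 2 ∸ t)) _ _ (begin
    2 * (n C 2 ∸ t) + ordEdges (compl (adj G)) ≡⟨ cong (λ e → 2 * e + ordEdges (compl (adj G))) (sym G∈) ⟩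
    2 * edges G + ordEdges (compl (adj G))     ≡⟨ edges+compl ⟩
    2 * (n C 2)                                ≡⟨ cong (2 *_) (sym (NP.m∸n+n≡m t≤C)) ⟩
    2 * (n C 2 ∸ t + t)                        ≡⟨ NP.*-distribˡ-+ 2 (n C 2 ∸ t) t ⟩
    2 * (n C 2 ∸ t) + 2 * t                    ∎)

  ∈-compl⁻ : ∀ {t} → t ≤ n C 2 → ordEdges (compl (adj G)) ≡ 2 * t → InG n (n C 2 ∸ t) G
  ∈-compl⁻ {t} t≤C e = NP.*-cancelˡ-≡ _ _ 2 (NP.+-cancelʳ-≡ (2 * t) _ _ (begin
    2 * edges G + 2 * t                        ≡⟨ cong (2 * edges G +_) (sym e) ⟩
    2 * edges G + ordEdges (compl (adj G))     ≡⟨ edges+compl ⟩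
    2 * (n C 2)                                ≡⟨ cong (2 *_) (sym (NP.m∸n+n≡m t≤C)) ⟩
    2 * (n C 2 ∸ t + t)                        ≡⟨ NP.*-distribˡ-+ 2 (n C 2 ∸ t) t ⟩
    2 * (n C 2 ∸ t) + 2 * t                    ∎))

M₁-compl-≤ : ∀ {N} (G S : Graph (suc N)) → ordEdges (compl (adj G)) ≡ ordEdges (compl (adj S)) →
  sqDegSum (compl (adj G)) ≤ sqDegSum (compl (adj S)) → M₁ G ≤ M₁ S
M₁-compl-≤ {N} G S e le = NP.+-cancelʳ-≤ (2 * N * ordEdges (compl (adj G))) (M₁ G) (M₁ S)
  (subst₂ _≤_ (sym (CG.sqDegSum-compl)) (trans (sym CS.sqDegSum-compl) (cong (λ x → M₁ S + 2 * N * x) (sym e)))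
          (NP.+-monoʳ-≤ (suc N * (N * N)) le))
  where
  module CG = Complement (adj G) (adj-sym G) (irrefl G)
  module CS = Complement (adj S) (adj-sym S) (irrefl S)

M₁-compl-≤⁻ : ∀ {N} (G S : Graph (suc N)) → ordEdges (compl (adj G)) ≡ ordEdges (compl (adj S)) →
  M₁ G ≤ M₁ S → sqDegSum (compl (adj G)) ≤ sqDegSum (compl (adj S))
M₁-compl-≤⁻ {N} G S e le = NP.+-cancelˡ-≤ (suc N * (N * N)) _ _
  (subst₂ _≤_ CG.sqDegSum-compl (trans (cong (λ x → M₁ S + 2 * N * x) e) CS.sqDegSum-compl)
          (NP.+-monoˡ-≤ (2 * N * ordEdges (compl (adj G))) le))
  where
  module CG = Complement (adj G) (adj-sym G) (irrefl G)
  module CS = Complement (adj S) (adj-sym S) (irrefl S)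

compl-cancel : ∀ {n} (G S : Graph n) → compl (adj G) ≃ compl (adj S) → G ≅ S
compl-cancel G S iso =
  ≃⇒≅ G S (≐-≃ (λ u v → sym (compl-involutive (adj G) (irrefl G) u v)) (≃-≐ (compl-≃ iso) (compl-involutive (adj S) (irrefl S))))

-- By the complement identities H(G) − H(S) = H(S̄) − H(Ḡ); a, b, a₃, b₃ are the invariants of Ḡ and S̄.
complement-< : ∀ a b a₃ b₃ x y x₃ y₃ → a + x ≡ b + y → a₃ + x₃ ≡ b₃ + y₃ →
  b + 2 * a₃ < a + 2 * b₃ → x + 2 * y₃ < y + 2 * x₃
complement-< a b a₃ b₃ x y x₃ y₃ e₂ e₃ lt = NP.+-cancelˡ-< (a + 2 * b₃) _ _
  (subst (_< (a + 2 * b₃) + (y + 2 * x₃)) (sym shift) (NP.+-monoˡ-< (y + 2 * x₃) lt))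
  where
  regroup : ∀ p q r s → (p + 2 * q) + (r + 2 * s) ≡ (p + r) + 2 * (q + s)
  regroup = solve-∀
  shift : (a + 2 * b₃) + (x + 2 * y₃) ≡ (b + 2 * a₃) + (y + 2 * x₃)
  shift = begin
    (a + 2 * b₃) + (x + 2 * y₃)  ≡⟨ regroup a b₃ x y₃ ⟩
    (a + x) + 2 * (b₃ + y₃)      ≡⟨ cong₂ (λ p q → p + 2 * q) e₂ (sym e₃) ⟩
    (b + y) + 2 * (a₃ + x₃)      ≡⟨ sym (regroup b a₃ y x₃) ⟩
    (b + 2 * a₃) + (y + 2 * x₃)  ∎

-- Uniqueness of the H-optimal graph

open Canonical

data Extremal {n} (t : ℕ) (A : Adj n) : Set where
  star-like     : A ≃ star t → Extremal t A
  triangle-like : t ≡ 3 → A ≃ triangle → Extremal t A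

few-edges : ∀ {R} t → t ≤ 3 → (A : Adj (4 + R)) → Symmetric A → Irreflexive A → ordEdges A ≡ 2 * t →
  sqDegSum A < sqDegSum (star {4 + R} t) ⊎ Extremal t A
few-edges 0 _ A sym-A irr-A e = inj₂ (star-like (≐⇒≃ λ u v → trans (no-edges A e u v) (sym (star-zero u v))))
few-edges {R} 1 _ A sym-A irr-A e = from-one (one-edge A sym-A irr-A e)
  where
  from-one : (Σ (Fin (4 + R)) λ x → Σ (Fin (4 + R)) λ y → OneEdge A x y) → sqDegSum A < sqDegSum (star {4 + R} 1) ⊎ Extremal 1 A
  from-one (_ , _ , one) = inj₂ (star-like (≐-≃ (OneEdge.shape one) (edge≃star (OneEdge.x≢y one))))
few-edges {R} 2 _ A sym-A irr-A e = from-two (two-edges A sym-A irr-A e)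
  where
  from-two : TwoEdges A → sqDegSum A < sqDegSum (star {4 + R} 2) ⊎ Extremal 2 A
  from-two (inj₁ (c , a , b , w)) = inj₂ (star-like (≐-≃ shape (path₃≃star c≢a c≢b a≢b)))
    where open IsPath₃ w
  from-two (inj₂ (q4 , _)) = inj₁ (subst₂ _<_ (sym q4) (sym (star₂-sqDegSum {R})) (NP.<ᵇ⇒< 4 6 tt))
few-edges {R} 3 _ A sym-A irr-A e = from-three (three-edges A sym-A irr-A e)
  where
  from-three : ThreeEdges A → sqDegSum A < sqDegSum (star {4 + R} 3) ⊎ Extremal 3 A
  from-three (inj₁ lt) = inj₁ (subst (sqDegSum A <_) (sym (star₃-sqDegSum {R})) lt)
  from-three (inj₂ (inj₁ (c , a , b , d , w))) = inj₂ (star-like (≐-≃ shape (claw≃star c≢a c≢b c≢d a≢b a≢d b≢d)))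
    where open IsClaw w
  from-three (inj₂ (inj₂ (c , a , b , w))) = inj₂ (triangle-like refl (≐-≃ shape (triangleOn≃triangle c≢a c≢b a≢b)))
    where open IsTriangle w
few-edges (suc (suc (suc (suc _)))) (s≤s (s≤s (s≤s ())))

extremal-sqDegSum : ∀ {R t} {A : Adj (4 + R)} → Extremal t A → sqDegSum A ≡ sqDegSum (star {4 + R} t)
extremal-sqDegSum (star-like iso) = sqDegSum-≃ iso
extremal-sqDegSum {R} (triangle-like refl iso) = trans (sqDegSum-≃ iso) (trans (triangle-sqDegSum {R}) (sym (star₃-sqDegSum {R})))

sqDegSum-few-edges : ∀ {R} t → t ≤ 3 → (A : Adj (4 + R)) → Symmetric A → Irreflexive A → ordEdges A ≡ 2 * t →
  sqDegSum A ≤ sqDegSum (star {4 + R} t)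
sqDegSum-few-edges t t≤3 A sym-A irr-A e = [ NP.<⇒≤ , (λ x → NP.≤-reflexive (extremal-sqDegSum x)) ]′ (few-edges t t≤3 A sym-A irr-A e)

UniqueHOptimal : (n m : ℕ) → Graph n → Set
UniqueHOptimal n m S = HOptimal n m S × (∀ (G : Graph n) → HOptimal n m G → G ≅ S)

unique-H-optimal : ∀ {n m} (S : Graph n) → InG n m S → (∀ G → InG n m G → M₁ G ≤ M₁ S) →
  (∀ G → InG n m G → M₁ S ≤ M₁ G → G ≅ S ⊎ H G ℤ.< H S) → UniqueHOptimal n m S
unique-H-optimal {n} {m} S S∈ bound classify = (S-optimal , S-maximal) , unique
  where
  S-optimal : MOptimal n m S
  S-optimal = S∈ , bound
  S-maximal : ∀ G → MOptimal n m G → H G ℤ.≤ H S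
  S-maximal G (G∈ , G-max) with classify G G∈ (G-max S S∈)
  ... | inj₁ iso = ℤP.≤-reflexive (H-≃ G S (≅⇒≃ G S iso))
  ... | inj₂ lt  = ℤP.<⇒≤ lt
  unique : ∀ G → HOptimal n m G → G ≅ S
  unique G ((G∈ , G-max) , G-H-max) with classify G G∈ (G-max S S∈)
  ... | inj₁ iso = iso
  ... | inj₂ lt  = ⊥-elim (ℤP.<⇒≱ lt (G-H-max S S-optimal))

small-case : ∀ {R} t → t ≤ 3 → (S : Graph (4 + R)) → adj S ≐ star t → UniqueHOptimal (4 + R) t S
small-case {R} t t≤3 S S≐star = unique-H-optimal S S∈ bound classify
  where
  open Conversion
  S≃star = ≐⇒≃ S≐star
  ordEdges-∈ : ∀ G → InG (4 + R) t G → ordEdges (adj G) ≡ 2 * t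
  ordEdges-∈ G G∈ = trans (ordEdges≡2*edges G) (cong (2 *_) G∈)
  S∈ : InG (4 + R) t S
  S∈ = NP.*-cancelˡ-≡ _ _ 2 (trans (sym (ordEdges≡2*edges S)) (trans (ordEdges-≃ S≃star) (star-ordEdges {R} t t≤3)))
  bound : ∀ G → InG (4 + R) t G → M₁ G ≤ M₁ S
  bound G G∈ = subst (M₁ G ≤_) (sym (sqDegSum-≃ S≃star))
                     (sqDegSum-few-edges t t≤3 (adj G) (adj-sym G) (irrefl G) (ordEdges-∈ G G∈))
  classify : ∀ G → InG (4 + R) t G → M₁ S ≤ M₁ G → G ≅ S ⊎ H G ℤ.< H S
  classify G G∈ S≤G = resolve (few-edges t t≤3 (adj G) (adj-sym G) (irrefl G) (ordEdges-∈ G G∈))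
    where
    resolve : sqDegSum (adj G) < sqDegSum (star {4 + R} t) ⊎ Extremal t (adj G) → G ≅ S ⊎ H G ℤ.< H S
    resolve (inj₁ lt) = ⊥-elim (NP.<-irrefl refl (NP.<-≤-trans lt (subst (_≤ M₁ G) (sqDegSum-≃ S≃star) S≤G)))
    resolve (inj₂ (star-like iso)) = inj₁ (≃⇒≅ G S (≃-trans iso (≃-sym S≃star)))
    resolve (inj₂ (triangle-like refl iso)) = inj₂ (H-< G S (subst₂ _<_
          (sym (cong₂ (λ x y → x + 2 * y) (ordM₂-≃ iso) (ordK₃-≃ S≃star)))
          (sym (cong₂ (λ x y → x + 2 * y) (ordM₂-≃ S≃star) (ordK₃-≃ iso)))
          (triangle-below-star₃ {R})))

data Complementary {n} : ℕ → Adj n → Set where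
  star-target     : ∀ {t} → t ≤ 2 → Complementary t (star t)
  triangle-target : Complementary 3 triangle

complementary-≤3 : ∀ {n t} {Y : Adj n} → Complementary t Y → t ≤ 3
complementary-≤3 (star-target t≤2) = NP.m≤n⇒m≤1+n t≤2
complementary-≤3 triangle-target   = NP.≤-refl

complementary-ordEdges : ∀ {R t} {Y : Adj (4 + R)} → Complementary t Y → ordEdges Y ≡ 2 * t
complementary-ordEdges {R} (star-target {t} t≤2) = star-ordEdges {R} t (NP.m≤n⇒m≤1+n t≤2)
complementary-ordEdges {R} triangle-target = triangle-ordEdges {R}

complementary-sqDegSum : ∀ {R t} {Y : Adj (4 + R)} → Complementary t Y → sqDegSum Y ≡ sqDegSum (star {4 + R} t)
complementary-sqDegSum (star-target _) = refl
complementary-sqDegSum {R} triangle-target = trans (triangle-sqDegSum {R}) (sym (star₃-sqDegSum {R}))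

complement-resolve : ∀ {R t} {Y : Adj (4 + R)} → Complementary t Y → (G S : Graph (4 + R)) →
  compl (adj S) ≃ Y → Extremal t (compl (adj G)) → G ≅ S ⊎ H G ℤ.< H S
complement-resolve (star-target _) G S S̄≃Y (star-like iso) = inj₁ (compl-cancel G S (≃-trans iso (≃-sym S̄≃Y)))
complement-resolve (star-target (s≤s (s≤s ()))) G S S̄≃Y (triangle-like refl iso)
complement-resolve triangle-target G S S̄≃Y (triangle-like _ iso) = inj₁ (compl-cancel G S (≃-trans iso (≃-sym S̄≃Y)))
complement-resolve {R} triangle-target G S S̄≃Y (star-like iso) = inj₂ (H-< G S
  (complement-< (ordM₂ (star {4 + R} 3)) (ordM₂ (triangle {4 + R})) (ordK₃ (star {4 + R} 3)) (ordK₃ (triangle {4 + R}))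
                (ordM₂ (adj G)) (ordM₂ (adj S)) (ordK₃ (adj G)) (ordK₃ (adj S))
    (sums (ordM₂-compl-sum Ḡ-sym Ḡ-irr S̄-sym S̄-irr ordEdges-eq sqDegSum-eq) ordM₂-≃)
    (sums (ordK₃-compl-sum Ḡ-sym Ḡ-irr S̄-sym S̄-irr ordEdges-eq sqDegSum-eq) ordK₃-≃)
    (triangle-below-star₃ {R})))
  where
  Ḡ = compl (adj G)
  S̄ = compl (adj S)
  Ḡ-sym = compl-sym (adj G) (adj-sym G)
  S̄-sym = compl-sym (adj S) (adj-sym S)
  Ḡ-irr = compl-irrefl (adj G)
  S̄-irr = compl-irrefl (adj S)
  ordEdges-eq : ordEdges Ḡ ≡ ordEdges S̄
  ordEdges-eq = trans (ordEdges-≃ iso) (trans (star-ordEdges {R} 3 NP.≤-refl)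
                      (trans (sym (triangle-ordEdges {R})) (sym (ordEdges-≃ S̄≃Y))))
  sqDegSum-eq : sqDegSum Ḡ ≡ sqDegSum S̄
  sqDegSum-eq = trans (sqDegSum-≃ iso) (trans (star₃-sqDegSum {R}) (trans (sym (triangle-sqDegSum {R})) (sym (sqDegSum-≃ S̄≃Y))))
  sums : ∀ {f : Adj (4 + R) → ℕ} → f Ḡ + f (compl Ḡ) ≡ f S̄ + f (compl S̄) →
         (∀ {A B : Adj (4 + R)} → A ≃ B → f A ≡ f B) → f (star 3) + f (adj G) ≡ f triangle + f (adj S)
  sums {f} e f-≃ = trans (cong₂ _+_ (sym (f-≃ iso)) (f-≃ (≐⇒≃ λ u v → sym (compl-involutive (adj G) (irrefl G) u v))))
                    (trans e (cong₂ _+_ (f-≃ S̄≃Y) (f-≃ (≐⇒≃ (compl-involutive (adj S) (irrefl S))))))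

complement-case : ∀ {R t} {Y : Adj (4 + R)} → Complementary t Y → (S : Graph (4 + R)) → compl (adj S) ≃ Y →
  UniqueHOptimal (4 + R) ((4 + R) C 2 ∸ t) S
complement-case {R} {t} {Y} target S S̄≃Y = unique-H-optimal S S∈ bound classify
  where
  t≤3 = complementary-≤3 target
  t≤C : t ≤ (4 + R) C 2
  t≤C = NP.≤-trans t≤3 (NP.≤-trans (NP.≤ᵇ⇒≤ 3 6 tt) (C₂-mono {4} (NP.m≤m+n 4 R)))
  S̄-ordEdges : ordEdges (compl (adj S)) ≡ 2 * t
  S̄-ordEdges = trans (ordEdges-≃ S̄≃Y) (complementary-ordEdges target)
  S̄-sqDegSum : sqDegSum (compl (adj S)) ≡ sqDegSum (star {4 + R} t)
  S̄-sqDegSum = trans (sqDegSum-≃ S̄≃Y) (complementary-sqDegSum target)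
  S∈ = ∈-compl⁻ S t≤C S̄-ordEdges
  few-edges-compl : ∀ G → InG (4 + R) ((4 + R) C 2 ∸ t) G →
    sqDegSum (compl (adj G)) < sqDegSum (star {4 + R} t) ⊎ Extremal t (compl (adj G))
  few-edges-compl G G∈ = few-edges t t≤3 (compl (adj G)) (compl-sym (adj G) (adj-sym G)) (compl-irrefl (adj G)) (∈-compl G t≤C G∈)
  bound : ∀ G → InG (4 + R) ((4 + R) C 2 ∸ t) G → M₁ G ≤ M₁ S
  bound G G∈ = M₁-compl-≤ G S (trans (∈-compl G t≤C G∈) (sym S̄-ordEdges))
    (subst (sqDegSum (compl (adj G)) ≤_) (sym S̄-sqDegSum) (sqDegSum-few-edges t t≤3 (compl (adj G)) (compl-sym (adj G) (adj-sym G))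
                                                         (compl-irrefl (adj G)) (∈-compl G t≤C G∈)))
  classify : ∀ G → InG (4 + R) ((4 + R) C 2 ∸ t) G → M₁ S ≤ M₁ G → G ≅ S ⊎ H G ℤ.< H S
  classify G G∈ S≤G = [ (λ lt → ⊥-elim (NP.<-irrefl refl (NP.<-≤-trans lt (subst (_≤ sqDegSum (compl (adj G))) S̄-sqDegSum
                                 (M₁-compl-≤⁻ S G (trans S̄-ordEdges (sym (∈-compl G t≤C G∈))) S≤G)))))
                      , complement-resolve target G S S̄≃Y ]′ (few-edges-compl G G∈)

data SmallParameters (r t k j : ℕ) : Set where
  empty-parameters : t ≡ 0 → k ≡ 5 + r → j ≡ 5 + r → SmallParameters r t k j
  star-parameters  : k ≡ 4 + r → j ≡ t → SmallParameters r t k j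

small-parameters : ∀ r t k j → t ≤ 3 → j ≤ k → t + suc k C 2 ≡ (5 + r) C 2 + j → SmallParameters r t k j
small-parameters r t k j t≤3 j≤k eq with NP.<-cmp k (4 + r)
... | tri< k<4+r _ _ = ⊥-elim (NP.<-irrefl refl (NP.≤-trans big (NP.≤-trans (NP.≤-reflexive (sym eq)) small)))
  where
  small : t + suc k C 2 ≤ 3 + (4 + r) C 2
  small = NP.+-mono-≤ t≤3 (C₂-mono k<4+r)
  big : suc (3 + (4 + r) C 2) ≤ (5 + r) C 2 + j
  big = NP.≤-trans (NP.+-monoˡ-≤ ((4 + r) C 2) (NP.m≤m+n 4 r))
          (NP.≤-trans (NP.m≤m+n _ j) (NP.≤-reflexive (cong (_+ j) (sym (C₂-suc (4 + r))))))
... | tri≈ _ refl _ = star-parameters refl (sym (NP.+-cancelˡ-≡ ((5 + r) C 2) t j (trans (NP.+-comm ((5 + r) C 2) t) eq)))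
... | tri> _ _ k>4+r with NP.m≤n⇒m<n∨m≡n k>4+r
...   | inj₂ refl = empty-parameters t≡0 refl (trans (sym t+n≡j) (cong (_+ (5 + r)) t≡0))
  where
  t+n≡j : t + (5 + r) ≡ j
  t+n≡j = NP.+-cancelʳ-≡ ((5 + r) C 2) _ _
    (trans (NP.+-assoc t (5 + r) _) (trans (cong (t +_) (sym (C₂-suc (5 + r)))) (trans eq (NP.+-comm _ j))))
  t≡0 : t ≡ 0
  t≡0 = NP.n≤0⇒n≡0 (NP.+-cancelʳ-≤ (5 + r) t 0 (NP.≤-trans (NP.≤-reflexive t+n≡j) j≤k))
...   | inj₁ 5+r<k = ⊥-elim (NP.<-irrefl refl (NP.≤-trans big (NP.≤-trans (NP.≤-reflexive eq) (NP.+-monoʳ-≤ _ j≤k))))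
  where
  X = (5 + r) C 2
  big : suc (X + k) ≤ t + suc k C 2
  big = NP.≤-trans (NP.+-monoˡ-≤ k (NP.≤-trans (subst (_≤ X + (5 + r)) (NP.+-comm X 1) (NP.+-monoʳ-≤ X (s≤s z≤n)))
                                                (C₂-< 5+r<k)))
          (NP.≤-trans (NP.≤-reflexive (trans (NP.+-comm (k C 2) k) (sym (C₂-suc k)))) (NP.m≤n+m _ t))

small-quasiStar : ∀ r t k j → t ≤ 3 → j ≤ k → t + suc k C 2 ≡ (5 + r) C 2 + j →
  UniqueHOptimal (5 + r) t (quasiStar (5 + r) k j)
small-quasiStar r t k j t≤3 j≤k eq with small-parameters r t k j t≤3 j≤k eq
... | empty-parameters refl refl refl = small-case 0 z≤n (quasiStar (5 + r) (5 + r) (5 + r)) (quasiStar-empty (5 + r))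
... | star-parameters refl refl = small-case t t≤3 (quasiStar (5 + r) (4 + r) t) (quasiStar-front (4 + r) t)

-- The k′ and j′ of the quasi-star with C(n,2) − t edges.
co-k co-j : ℕ → ℕ
co-k 0 = 1
co-k 1 = 2
co-k 2 = 2
co-k _ = 3
co-j 0 = 1
co-j 1 = 2
co-j 2 = 1
co-j _ = 3

complement-parameters : ∀ r t k j → t ≤ 3 → 1 ≤ j → j ≤ k →
  ((5 + r) C 2 ∸ t) + suc k C 2 ≡ (5 + r) C 2 + j → k ≡ co-k t × j ≡ co-j t
complement-parameters r t k j t≤3 1≤j j≤k eq = solve-small k t j k≤3 t≤3 1≤j j≤k t+j≡C
  where
  X = (5 + r) C 2
  t≤X : t ≤ X
  t≤X = NP.≤-trans t≤3 (NP.≤-trans (NP.≤ᵇ⇒≤ 3 10 tt) (C₂-mono {5} (NP.m≤m+n 5 r)))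
  t+j≡C : t + j ≡ suc k C 2
  t+j≡C = sym (NP.+-cancelʳ-≡ X _ _ (begin
    suc k C 2 + X                  ≡⟨ cong (suc k C 2 +_) (sym (NP.m∸n+n≡m t≤X)) ⟩
    suc k C 2 + ((X ∸ t) + t)      ≡⟨ sym (NP.+-assoc (suc k C 2) (X ∸ t) t) ⟩
    (suc k C 2 + (X ∸ t)) + t      ≡⟨ cong (_+ t) (trans (NP.+-comm (suc k C 2) (X ∸ t)) eq) ⟩
    (X + j) + t                    ≡⟨ rotate X j t ⟩
    (t + j) + X                    ∎))
    where
    rotate : ∀ x j t → (x + j) + t ≡ (t + j) + x
    rotate = solve-∀
  k≤3 : k ≤ 3
  k≤3 with NP.≤-<-connex k 3
  ... | inj₁ le = le
  ... | inj₂ 3<k = ⊥-elim (NP.<-irrefl refl (NP.≤-trans lower above))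
    where
    lower : suc (3 + k) ≤ k + k C 2
    lower = NP.≤-trans (NP.≤-reflexive (NP.+-comm 4 k)) (NP.+-monoʳ-≤ k (NP.≤-trans (NP.<ᵇ⇒< 3 6 tt) (C₂-mono 3<k)))
    above : k + k C 2 ≤ 3 + k
    above = NP.≤-trans (NP.≤-reflexive (trans (sym (C₂-suc k)) (sym t+j≡C))) (NP.+-mono-≤ t≤3 j≤k)
  solve-small : ∀ k t j → k ≤ 3 → t ≤ 3 → 1 ≤ j → j ≤ k → t + j ≡ suc k C 2 → k ≡ co-k t × j ≡ co-j t
  solve-small 0 t j _ _ (s≤s _) () _
  solve-small 1 0 .1 _ _ _ _ refl = refl , refl
  solve-small 1 1 .0 _ _ () _ refl
  solve-small 1 2 j _ _ _ _ ()
  solve-small 1 3 j _ _ _ _ ()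
  solve-small 2 0 .3 _ _ _ (s≤s (s≤s ())) refl
  solve-small 2 1 .2 _ _ _ _ refl = refl , refl
  solve-small 2 2 .1 _ _ _ _ refl = refl , refl
  solve-small 2 3 .0 _ _ () _ refl
  solve-small 3 0 .6 _ _ _ (s≤s (s≤s (s≤s ()))) refl
  solve-small 3 1 .5 _ _ _ (s≤s (s≤s (s≤s ()))) refl
  solve-small 3 2 .4 _ _ _ (s≤s (s≤s (s≤s ()))) refl
  solve-small 3 3 .3 _ _ _ _ refl = refl , refl
  solve-small (suc (suc (suc (suc k)))) t j (s≤s (s≤s (s≤s ()))) _ _ _ _
  solve-small k (suc (suc (suc (suc t)))) j _ (s≤s (s≤s (s≤s ()))) _ _ _

compl-quasiStarᵒᵖ-far : ∀ {R} k j → (∀ i v → relᵒᵖ k j (4 ↑ʳ i) v ≡ true) →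
  ∀ (i : Fin R) v → compl (quasiStarᵒᵖ k j) (4 ↑ʳ i) v ≡ false
compl-quasiStarᵒᵖ-far k j core i v rewrite core i v with (4 ↑ʳ i) == v
... | true  = refl
... | false = refl

complement-target : ∀ {R} t → t ≤ 3 →
  Σ (Adj (4 + R)) λ Y → Complementary t Y × compl (quasiStarᵒᵖ (co-k t) (co-j t)) ≐ Y
complement-target {R} 0 _ = star 0 , star-target z≤n , ≐-from-prefix {4} {R} _ _
  (compl-sym _ (quasiStarᵒᵖ-sym 1 1)) (star-sym 0) (compl-quasiStarᵒᵖ-far 1 1 λ i v → refl) (star-far 0 z≤n) _
complement-target {R} 1 _ = star 1 , star-target (s≤s z≤n) , ≐-from-prefix {4} {R} _ _
  (compl-sym _ (quasiStarᵒᵖ-sym 2 2)) (star-sym 1) (compl-quasiStarᵒᵖ-far 2 2 λ i v → refl) (star-far 1 (s≤s z≤n)) _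
complement-target {R} 2 _ = star 2 , star-target (s≤s (s≤s z≤n)) , ≐-from-prefix {4} {R} _ _
  (compl-sym _ (quasiStarᵒᵖ-sym 2 1)) (star-sym 2) (compl-quasiStarᵒᵖ-far 2 1 λ i v → refl) (star-far 2 (s≤s (s≤s z≤n))) _
complement-target {R} 3 _ = triangle , triangle-target , ≐-from-prefix {4} {R} _ _
  (compl-sym _ (quasiStarᵒᵖ-sym 3 3)) triangle-sym (compl-quasiStarᵒᵖ-far 3 3 λ i v → refl) (λ i v → refl) _
complement-target (suc (suc (suc (suc _)))) (s≤s (s≤s (s≤s ())))

complement-quasiStar : ∀ r t k j → t ≤ 3 → 1 ≤ j → j ≤ k → ((5 + r) C 2 ∸ t) + suc k C 2 ≡ (5 + r) C 2 + j →
  UniqueHOptimal (5 + r) ((5 + r) C 2 ∸ t) (quasiStar (5 + r) k j)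
complement-quasiStar r t k j t≤3 1≤j j≤k eq with complement-parameters r t k j t≤3 1≤j j≤k eq
... | refl , refl with complement-target {suc r} t t≤3
...   | Y , target , co≐Y = complement-case target (quasiStar (5 + r) (co-k t) (co-j t))
        (≃-≐ (≃-sym (compl-≃ (quasiStar-opposite (5 + r) (co-k t) (co-j t)))) co≐Y)

lemma14 : (n m : ℕ) → 5 ≤ n →
    (m ≡ 0 ⊎ m ≡ 1 ⊎ m ≡ 2 ⊎ m ≡ 3 ⊎
     m ≡ n C 2 ⊎ m ≡ n C 2 ∸ 1 ⊎ m ≡ n C 2 ∸ 2 ⊎ m ≡ n C 2 ∸ 3) →
    (k′ j′ : ℕ) → 1 ≤ j′ → j′ ≤ k′ → m + suc k′ C 2 ≡ n C 2 + j′ →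
    HOptimal n m (quasiStar n k′ j′)
      × (∀ (G : Graph n) → HOptimal n m G → G ≅ quasiStar n k′ j′)
lemma14 .(5 + r) m (s≤s (s≤s (s≤s (s≤s (s≤s (z≤n {r})))))) m-cases k j 1≤j j≤k eq with m-cases
... | inj₁ refl = small-quasiStar r 0 k j z≤n j≤k eq
... | inj₂ (inj₁ refl) = small-quasiStar r 1 k j (s≤s z≤n) j≤k eq
... | inj₂ (inj₂ (inj₁ refl)) = small-quasiStar r 2 k j (s≤s (s≤s z≤n)) j≤k eq
... | inj₂ (inj₂ (inj₂ (inj₁ refl))) = small-quasiStar r 3 k j (s≤s (s≤s (s≤s z≤n))) j≤k eq
... | inj₂ (inj₂ (inj₂ (inj₂ (inj₁ refl)))) = complement-quasiStar r 0 k j z≤n 1≤j j≤k eq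
... | inj₂ (inj₂ (inj₂ (inj₂ (inj₂ (inj₁ refl))))) = complement-quasiStar r 1 k j (s≤s z≤n) 1≤j j≤k eq
... | inj₂ (inj₂ (inj₂ (inj₂ (inj₂ (inj₂ (inj₁ refl)))))) = complement-quasiStar r 2 k j (s≤s (s≤s z≤n)) 1≤j j≤k eq
... | inj₂ (inj₂ (inj₂ (inj₂ (inj₂ (inj₂ (inj₂ refl)))))) = complement-quasiStar r 3 k j (s≤s (s≤s (s≤s z≤n))) 1≤j j≤k eq
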